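{- Let $k\ge 4$ be an integer and let $\mathcal{S}_k$ be the graph with incoming vertices $i_1,\dots,i_k$ and outgoing vertices $o_1,\dots,o_k$ defined below. Then for all $j\neq m$ in $\{1,\dots,k\}$ there is no Hamiltonian path in $\mathcal{S}_k$ starting at $i_j$ and finishing at $o_m$.
   Context: A Hamiltonian path from $u$ to $w$ in a directed graph is a directed simple path starting at $u$, ending at $w$, visiting every vertex exactly once. "Undirected edge $(a,b)$" below means both directed edges $(a,b)$ and $(b,a)$. The directed graph $\mathcal{S}_k$ ($k\ge4$) has vertex set $\{1,2,\dots,2k-1\}$ and edges as follows. For even $k\ge4$: undirected edges $(4i-2,4i-1)$, $(4i-1,4i)$, $(4i,4i+1)$ for $i=1,\dots,\frac{k-2}{2}$; directed edges $(4i-2,4i+5)$ and $(4i+1,4i+2)$ for $i=1,\dots,\frac{k-4}{2}$; directed edges $(1,2)$, $(2k-6,2k-1)$, $(2k-3,2k-2)$, $(2k-2,1)$, $(2k-2,5)$, $(2k-1,2k-2)$. For odd $k\ge5$: undirected edges $(4i-2,4i-1)$, $(4i-1,4i)$, $(4i,4i+1)$ for $i=1,\dots,\frac{k-1}{2}$; directed edges $(4i-2,4i+5)$ and $(4i+1,4i+2)$ for $i=1,\dots,\frac{k-3}{2}$; directed edges $(1,2)$, $(2k-4,1)$, $(2k-2,5)$. In both cases the incoming vertices are $i_j=2j-1$ for $j=1,\dots,k$, and the outgoing vertices satisfy $o_{2j}=4j+3$ and $o_{2j+1}=4j-3$ for $j=1,\dots,\lfloor\frac{k-3}{2}\rfloor$;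 in addition, for even $k$: $o_1=3$, $o_{k-2}=2k-1$, $o_{k-1}=2k-7$, $o_k=2k-3$; for odd $k$: $o_1=2k-1$, $o_{k-1}=3$, $o_k=2k-5$. -}

module Defs where

open import Data.Nat using (ℕ; zero; suc; _+_; _*_; _∸_; _≤_; _<_)
open import Data.Nat.DivMod using (_%_)
open import Data.Maybe using (Maybe; just)
open import Data.List using (List; head; last)
open import Data.List.Relation.Unary.All using (All)
open import Data.List.Relation.Unary.Linked using (Linked)
open import Data.List.Relation.Unary.Unique.Propositional using (Unique)
open import Data.List.Membership.Propositional using (_∈_)
open import Data.Product using (_×_)
open import Relation.Binary.PropositionalEquality using (_≡_)

IsEven : ℕ → Set
IsEven k = k % 2 ≡ 0

IsOdd : ℕ → Set
IsOdd k = k % 2 ≡ 1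

-- The directed edges of the graph S_k on vertex set {1,…,2k-1}.
-- "Undirected edge (a,b)" contributes both (a,b) and (b,a).
data Edge (k : ℕ) : ℕ → ℕ → Set where
  ------------------------------------------------------------ even k
  -- undirected (4i-2,4i-1), (4i-1,4i), (4i,4i+1), i = 1..(k-2)/2  (i.e. 2i+2 ≤ k)
  ev-a  : IsEven k → (i : ℕ) → 1 ≤ i → 2 * i + 2 ≤ k → Edge k (4 * i ∸ 2) (4 * i ∸ 1)
  ev-a' : IsEven k → (i : ℕ) → 1 ≤ i → 2 * i + 2 ≤ k → Edge k (4 * i ∸ 1) (4 * i ∸ 2)
  ev-b  : IsEven k → (i : ℕ) → 1 ≤ i → 2 * i + 2 ≤ k → Edge k (4 * i ∸ 1) (4 * i)
  ev-b' : IsEven k → (i : ℕ) → 1 ≤ i → 2 * i + 2 ≤ k → Edge k (4 * i) (4 * i ∸ 1)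
  ev-c  : IsEven k → (i : ℕ) → 1 ≤ i → 2 * i + 2 ≤ k → Edge k (4 * i) (4 * i + 1)
  ev-c' : IsEven k → (i : ℕ) → 1 ≤ i → 2 * i + 2 ≤ k → Edge k (4 * i + 1) (4 * i)
  -- directed (4i-2,4i+5), (4i+1,4i+2), i = 1..(k-4)/2  (i.e. 2i+4 ≤ k)
  ev-d  : IsEven k → (i : ℕ) → 1 ≤ i → 2 * i + 4 ≤ k → Edge k (4 * i ∸ 2) (4 * i + 5)
  ev-e  : IsEven k → (i : ℕ) → 1 ≤ i → 2 * i + 4 ≤ k → Edge k (4 * i + 1) (4 * i + 2)
  ev-f1 : IsEven k → Edge k 1 2
  ev-f2 : IsEven k → Edge k (2 * k ∸ 6) (2 * k ∸ 1)
  ev-f3 : IsEven k → Edge k (2 * k ∸ 3) (2 * k ∸ 2)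
  ev-f4 : IsEven k → Edge k (2 * k ∸ 2) 1
  ev-f5 : IsEven k → Edge k (2 * k ∸ 2) 5
  ev-f6 : IsEven k → Edge k (2 * k ∸ 1) (2 * k ∸ 2)
  ------------------------------------------------------------ odd k
  -- undirected (4i-2,4i-1), (4i-1,4i), (4i,4i+1), i = 1..(k-1)/2  (i.e. 2i+1 ≤ k)
  od-a  : IsOdd k → (i : ℕ) → 1 ≤ i → 2 * i + 1 ≤ k → Edge k (4 * i ∸ 2) (4 * i ∸ 1)
  od-a' : IsOdd k → (i : ℕ) → 1 ≤ i → 2 * i + 1 ≤ k → Edge k (4 * i ∸ 1) (4 * i ∸ 2)
  od-b  : IsOdd k → (i : ℕ) → 1 ≤ i → 2 * i + 1 ≤ k → Edge k (4 * i ∸ 1) (4 * i)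
  od-b' : IsOdd k → (i : ℕ) → 1 ≤ i → 2 * i + 1 ≤ k → Edge k (4 * i) (4 * i ∸ 1)
  od-c  : IsOdd k → (i : ℕ) → 1 ≤ i → 2 * i + 1 ≤ k → Edge k (4 * i) (4 * i + 1)
  od-c' : IsOdd k → (i : ℕ) → 1 ≤ i → 2 * i + 1 ≤ k → Edge k (4 * i + 1) (4 * i)
  -- directed (4i-2,4i+5), (4i+1,4i+2), i = 1..(k-3)/2  (i.e. 2i+3 ≤ k)
  od-d  : IsOdd k → (i : ℕ) → 1 ≤ i → 2 * i + 3 ≤ k → Edge k (4 * i ∸ 2) (4 * i + 5)
  od-e  : IsOdd k → (i : ℕ) → 1 ≤ i → 2 * i + 3 ≤ k → Edge k (4 * i + 1) (4 * i + 2)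
  od-f1 : IsOdd k → Edge k 1 2
  od-f2 : IsOdd k → Edge k (2 * k ∸ 4) 1
  od-f3 : IsOdd k → Edge k (2 * k ∸ 2) 5

inV : ℕ → ℕ
inV j = 2 * j ∸ 1

-- Outgoing vertices: Out k m v means o_m = v in S_k.
-- (For each 1 ≤ m ≤ k exactly one v satisfies it.)
data Out (k : ℕ) : ℕ → ℕ → Set where
  -- o_{2j} = 4j+3, o_{2j+1} = 4j-3 for j = 1..⌊(k-3)/2⌋  (i.e. 2j+3 ≤ k)
  o-even : (j : ℕ) → 1 ≤ j → 2 * j + 3 ≤ k → Out k (2 * j) (4 * j + 3)
  o-odd  : (j : ℕ) → 1 ≤ j → 2 * j + 3 ≤ k → Out k (2 * j + 1) (4 * j ∸ 3)
  ev-o1  : IsEven k → Out k 1 3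
  ev-ok2 : IsEven k → Out k (k ∸ 2) (2 * k ∸ 1)
  ev-ok1 : IsEven k → Out k (k ∸ 1) (2 * k ∸ 7)
  ev-ok  : IsEven k → Out k k (2 * k ∸ 3)
  od-o1  : IsOdd k → Out k 1 (2 * k ∸ 1)
  od-ok1 : IsOdd k → Out k (k ∸ 1) 3
  od-ok  : IsOdd k → Out k k (2 * k ∸ 5)

record HamPath (E : ℕ → ℕ → Set) (n u w : ℕ) : Set where
  field
    path      : List ℕ
    starts    : head path ≡ just u
    ends      : last path ≡ just w
    edges     : Linked E path
    simple    : Unique path
    inRange   : All (λ v → 1 ≤ v × v ≤ n) path
    spanning  : (v : ℕ) → 1 ≤ v → v ≤ n → v ∈ path

HamPathS : ℕ → ℕ → ℕ → Set
HamPathS k u w = HamPath (Edge k) (2 * k ∸ 1) u w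

-- Relabel the vertices 4i−2, 4i−1, 4i, 4i+1 of S_k as A i, B i, C i, D i and
-- vertex 1 as D 0.  Then S_k is a chain of blocks A i – B i – C i – D i, joined
-- by the one-way arcs A i → D (i+1) and D i → A (i+1) and closed up by a few
-- extra arcs, and every incoming or outgoing vertex is a B or a D.  Apart from
-- C K → D 1 for odd k, B i and C i are adjacent only to their block neighbours,
-- so a Hamiltonian path that enters a block not containing its ends must run
-- through the whole block and leave it at the other side.  Propagating this
-- along the chain shows that a Hamiltonian path starting at i_j is completely
-- forced and ends at o_j, hence not at o_m for any m ≠ j.
module Submission where

open import Data.Empty using (⊥; ⊥-elim)
open import Data.List using (List; []; _∷_; head; last; length; map)
open import Data.List.Properties using (head-map; last-map; length-removeAt′)
open import Data.List.Membership.Propositional using (_∈_)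
open import Data.List.Membership.Propositional.Properties using (∈-map⁺)
open import Data.List.Relation.Unary.All using (All; []; _∷_)
open import Data.List.Relation.Unary.All.Properties using (All¬⇒¬Any)
open import Data.List.Relation.Unary.Any using (here; there; index; _─_)
open import Data.List.Relation.Unary.AllPairs using ([]; _∷_; allPairs?)
import Data.List.Relation.Unary.Linked as Linked
open import Data.List.Relation.Unary.Linked using (Linked; []; [-]; _∷_)
open import Data.List.Relation.Unary.Linked.Properties using (map⁺)
open import Data.List.Relation.Unary.Unique.Propositional using (Unique)
import Data.List.Relation.Unary.Unique.Propositional.Properties as Unique
open import Data.Maybe as Maybe using (just)
open import Data.Nat using (ℕ; zero; suc; _+_; _*_; _∸_; _≤_; _<_; z≤n; s≤s; _≟_; _≤?_)
open import Data.Nat.DivMod using (_%_; [m+kn]%n≡m%n)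
open import Data.Nat.Properties
open import Data.Nat.Tactic.RingSolver using (solve-∀)
open import Data.Product using (∃; _×_; _,_; proj₁; proj₂)
open import Data.Sum using (_⊎_; inj₁; inj₂)
open import Function using (case_of_)
open import Relation.Binary.PropositionalEquality
open import Relation.Nullary using (¬_; Dec; yes; no)
open import Relation.Nullary.Decidable using (map′; from-yes; ¬?)

open import Defs

-- The block graph

data Vertex : Set where
  A B C D : ℕ → Vertex

shift : Vertex → Vertex
shift (A i) = A (suc i)
shift (B i) = B (suc i)
shift (C i) = C (suc i)
shift (D i) = D (suc i)

decode : ℕ → Vertex
decode 0 = A 0
decode 1 = B 0
decode 2 = C 0
decode 3 = D 0
decode (suc (suc (suc (suc n)))) = shift (decode n)

code : Vertex → ℕ
code (A i) = 4 * i
code (B i) = 1 + 4 * i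
code (C i) = 2 + 4 * i
code (D i) = 3 + 4 * i

decode-code : ∀ v → decode (code v) ≡ v
decode-code (A zero) = refl
decode-code (B zero) = refl
decode-code (C zero) = refl
decode-code (D zero) = refl
decode-code (A (suc i)) = trans (cong decode (*-suc 4 i)) (cong shift (decode-code (A i)))
decode-code (B (suc i)) = trans (cong (λ n → decode (1 + n)) (*-suc 4 i)) (cong shift (decode-code (B i)))
decode-code (C (suc i)) = trans (cong (λ n → decode (2 + n)) (*-suc 4 i)) (cong shift (decode-code (C i)))
decode-code (D (suc i)) = trans (cong (λ n → decode (3 + n)) (*-suc 4 i)) (cong shift (decode-code (D i)))

code-shift : ∀ v → code (shift v) ≡ 4 + code v
code-shift (A i) = *-suc 4 i
code-shift (B i) = cong (1 +_) (*-suc 4 i)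
code-shift (C i) = cong (2 +_) (*-suc 4 i)
code-shift (D i) = cong (3 +_) (*-suc 4 i)

code-decode : ∀ n → code (decode n) ≡ n
code-decode 0 = refl
code-decode 1 = refl
code-decode 2 = refl
code-decode 3 = refl
code-decode (suc (suc (suc (suc n)))) = trans (code-shift (decode n)) (cong (4 +_) (code-decode n))

code-injective : ∀ {v w} → code v ≡ code w → v ≡ w
code-injective {v} {w} e = trans (sym (decode-code v)) (trans (cong decode e) (decode-code w))

_≟ᵥ_ : (v w : Vertex) → Dec (v ≡ w)
v ≟ᵥ w = map′ code-injective (cong code) (code v ≟ code w)

data Parity : Set where
  odd even : Parity

parity-cases : ∀ q → q ≡ odd ⊎ q ≡ even
parity-cases odd = inj₁ refl
parity-cases even = inj₂ refl

-- Arc p K is S_k for k = 2K+1 (p = odd) or k = 2K+2 (p = even), with blocks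
-- 1, …, K; for even k the two remaining vertices 2k−2 and 2k−1 are
-- X = A (K+1) and Y = B (K+1).
data Arc : Parity → ℕ → Vertex → Vertex → Set where
  ab : ∀ {p K} i → 1 ≤ i → i ≤ K → Arc p K (A i) (B i)
  ba : ∀ {p K} i → 1 ≤ i → i ≤ K → Arc p K (B i) (A i)
  bc : ∀ {p K} i → 1 ≤ i → i ≤ K → Arc p K (B i) (C i)
  cb : ∀ {p K} i → 1 ≤ i → i ≤ K → Arc p K (C i) (B i)
  cd : ∀ {p K} i → 1 ≤ i → i ≤ K → Arc p K (C i) (D i)
  dc : ∀ {p K} i → 1 ≤ i → i ≤ K → Arc p K (D i) (C i)
  ad : ∀ {p K} i → 1 ≤ i → suc i ≤ K → Arc p K (A i) (D (suc i))
  da : ∀ {p K} i → 1 ≤ i → suc i ≤ K → Arc p K (D i) (A (suc i))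
  d0-a1 : ∀ {p K} → Arc p K (D 0) (A 1)
  ak-d0 : ∀ {K} → Arc odd K (A K) (D 0)
  ck-d1 : ∀ {K} → Arc odd K (C K) (D 1)
  ak-y : ∀ {K} → Arc even K (A K) (B (suc K))
  dk-x : ∀ {K} → Arc even K (D K) (A (suc K))
  x-d0 : ∀ {K} → Arc even K (A (suc K)) (D 0)
  x-d1 : ∀ {K} → Arc even K (A (suc K)) (D 1)
  y-x : ∀ {K} → Arc even K (B (suc K)) (A (suc K))

data IsVertex : Parity → ℕ → Vertex → Set where
  v-D0 : ∀ {p K} → IsVertex p K (D 0)
  v-A : ∀ {p K i} → 1 ≤ i → i ≤ K → IsVertex p K (A i)
  v-B : ∀ {p K i} → 1 ≤ i → i ≤ K → IsVertex p K (B i)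
  v-C : ∀ {p K i} → 1 ≤ i → i ≤ K → IsVertex p K (C i)
  v-D : ∀ {p K i} → 1 ≤ i → i ≤ K → IsVertex p K (D i)
  v-X : ∀ {K} → IsVertex even K (A (suc K))
  v-Y : ∀ {K} → IsVertex even K (B (suc K))

data IsBD : Vertex → Set where
  bd-B : ∀ {i} → IsBD (B i)
  bd-D : ∀ {i} → IsBD (D i)

from-B : ∀ {p K i y} → Arc p K (B i) y → y ≡ A i ⊎ y ≡ C i
from-B (ba i _ _) = inj₁ refl
from-B (bc i _ _) = inj₂ refl
from-B y-x = inj₁ refl

into-B : ∀ {p K i x} → i ≤ K → Arc p K x (B i) → x ≡ A i ⊎ x ≡ C i
into-B _ (ab i _ _) = inj₁ refl
into-B _ (cb i _ _) = inj₂ refl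
into-B le ak-y = ⊥-elim (1+n≰n le)

into-C : ∀ {p K i x} → Arc p K x (C i) → x ≡ B i ⊎ x ≡ D i
into-C (bc i _ _) = inj₁ refl
into-C (dc i _ _) = inj₂ refl

from-C : ∀ {p K i y} → Arc p K (C i) y → y ≡ B i ⊎ y ≡ D i ⊎ (p ≡ odd × i ≡ K × y ≡ D 1)
from-C (cb i _ _) = inj₁ refl
from-C (cd i _ _) = inj₂ (inj₁ refl)
from-C ck-d1 = inj₂ (inj₂ (refl , refl , refl))

from-C-interior : ∀ {p K i y} → (i < K ⊎ p ≡ even) → Arc p K (C i) y → y ≡ B i ⊎ y ≡ D i
from-C-interior h g with from-C g
... | inj₁ e = inj₁ e
... | inj₂ (inj₁ e) = inj₂ e
from-C-interior (inj₁ lt) g | inj₂ (inj₂ (_ , refl , _)) = ⊥-elim (n≮n _ lt)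
from-C-interior (inj₂ ()) g | inj₂ (inj₂ (refl , _ , _))

into-A : ∀ {p K j x} → Arc p K x (A (suc j)) → x ≡ B (suc j) ⊎ x ≡ D j
into-A (ba i _ _) = inj₁ refl
into-A (da i _ _) = inj₂ refl
into-A d0-a1 = inj₂ refl
into-A dk-x = inj₂ refl
into-A y-x = inj₁ refl

from-A-interior : ∀ {p K i y} → i < K → Arc p K (A i) y → y ≡ B i ⊎ y ≡ D (suc i)
from-A-interior _ (ab i _ _) = inj₁ refl
from-A-interior _ (ad i _ _) = inj₂ refl
from-A-interior lt ak-d0 = ⊥-elim (n≮n _ lt)
from-A-interior lt ak-y = ⊥-elim (n≮n _ lt)
from-A-interior lt x-d0 = ⊥-elim (1+n≰n (<⇒≤ lt))
from-A-interior lt x-d1 = ⊥-elim (1+n≰n (<⇒≤ lt))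

from-A-last-odd : ∀ {K y} → Arc odd K (A K) y → y ≡ B K ⊎ y ≡ D 0
from-A-last-odd (ab i _ _) = inj₁ refl
from-A-last-odd (ad i _ le) = ⊥-elim (1+n≰n le)
from-A-last-odd ak-d0 = inj₂ refl

from-A-last-even : ∀ {K y} → Arc even K (A K) y → y ≡ B K ⊎ y ≡ B (suc K)
from-A-last-even (ab i _ _) = inj₁ refl
from-A-last-even (ad i _ le) = ⊥-elim (1+n≰n le)
from-A-last-even ak-y = inj₂ refl

from-X : ∀ {K y} → Arc even K (A (suc K)) y → y ≡ D 0 ⊎ y ≡ D 1
from-X (ab i _ le) = ⊥-elim (1+n≰n le)
from-X (ad i _ le) = ⊥-elim (1+n≰n (<⇒≤ le))
from-X x-d0 = inj₁ refl
from-X x-d1 = inj₂ refl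

into-D-interior : ∀ {p K j x} → 1 ≤ j → Arc p K x (D (suc j)) → x ≡ C (suc j) ⊎ x ≡ A j
into-D-interior _ (cd i _ _) = inj₁ refl
into-D-interior _ (ad i _ _) = inj₂ refl
into-D-interior () ck-d1
into-D-interior () x-d1

into-D1-odd : ∀ {K x} → Arc odd K x (D 1) → x ≡ C 1 ⊎ x ≡ C K
into-D1-odd (cd i _ _) = inj₁ refl
into-D1-odd (ad i () _)
into-D1-odd ck-d1 = inj₂ refl

into-D1-even : ∀ {K x} → Arc even K x (D 1) → x ≡ C 1 ⊎ x ≡ A (suc K)
into-D1-even (cd i _ _) = inj₁ refl
into-D1-even (ad i () _)
into-D1-even x-d1 = inj₂ refl

into-D0-odd : ∀ {K x} → Arc odd K x (D 0) → x ≡ A K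
into-D0-odd (cd i () _)
into-D0-odd ak-d0 = refl

into-D0-even : ∀ {K x} → Arc even K x (D 0) → x ≡ A (suc K)
into-D0-even (cd i () _)
into-D0-even x-d0 = refl

from-D : ∀ {p K i y} → Arc p K (D i) y → y ≡ C i ⊎ y ≡ A (suc i)
from-D (dc i _ _) = inj₁ refl
from-D (da i _ _) = inj₂ refl
from-D d0-a1 = inj₂ refl
from-D dk-x = inj₂ refl

from-D0 : ∀ {p K y} → Arc p K (D 0) y → y ≡ A 1
from-D0 (dc i () _)
from-D0 d0-a1 = refl
from-D0 {even} {zero} dk-x = refl

from-D-last-odd : ∀ {K y} → 1 ≤ K → Arc odd K (D K) y → y ≡ C K
from-D-last-odd _ (dc i _ _) = refl
from-D-last-odd _ (da i _ le) = ⊥-elim (1+n≰n le)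
from-D-last-odd () d0-a1

from-Y : ∀ {K y} → Arc even K (B (suc K)) y → y ≡ A (suc K)
from-Y (ba i _ _) = refl
from-Y (bc i _ le) = ⊥-elim (1+n≰n le)
from-Y y-x = refl

-- Consecutive entries of a list

module _ {X : Set} where

  data Consecutive : List X → X → X → Set where
    here  : ∀ {x y l} → Consecutive (x ∷ y ∷ l) x y
    there : ∀ {z l x y} → Consecutive l x y → Consecutive (z ∷ l) x y

  consecutive-related : ∀ {R : X → X → Set} {l x y} → Linked R l → Consecutive l x y → R x y
  consecutive-related (r ∷ _) here = r
  consecutive-related (_ ∷ rs) (there c) = consecutive-related rs c
  consecutive-related [-] (there ())

  consecutive-∈ˡ : ∀ {l x y} → Consecutive l x y → x ∈ l
  consecutive-∈ˡ here = here refl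
  consecutive-∈ˡ (there c) = there (consecutive-∈ˡ c)

  consecutive-∈ʳ : ∀ {l x y} → Consecutive l x y → y ∈ l
  consecutive-∈ʳ here = there (here refl)
  consecutive-∈ʳ (there c) = there (consecutive-∈ʳ c)

  consecutive-∈-tail : ∀ {z l x y} → Consecutive (z ∷ l) x y → y ∈ l
  consecutive-∈-tail here = here refl
  consecutive-∈-tail (there c) = consecutive-∈ʳ c

  consecutive-functional : ∀ {l x y z} → Unique l → Consecutive l x y → Consecutive l x z → y ≡ z
  consecutive-functional _ here here = refl
  consecutive-functional (x∉ ∷ _) here (there c) = ⊥-elim (All¬⇒¬Any x∉ (consecutive-∈ˡ c))
  consecutive-functional (x∉ ∷ _) (there c) here = ⊥-elim (All¬⇒¬Any x∉ (consecutive-∈ˡ c))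
  consecutive-functional (_ ∷ u) (there c) (there c′) = consecutive-functional u c c′

  consecutive-injective : ∀ {l x y z} → Unique l → Consecutive l x y → Consecutive l z y → x ≡ z
  consecutive-injective _ here here = refl
  consecutive-injective (_ ∷ (y∉ ∷ _)) here (there c) = ⊥-elim (All¬⇒¬Any y∉ (consecutive-∈-tail c))
  consecutive-injective (_ ∷ (y∉ ∷ _)) (there c) here = ⊥-elim (All¬⇒¬Any y∉ (consecutive-∈-tail c))
  consecutive-injective (_ ∷ u) (there c) (there c′) = consecutive-injective u c c′

  consecutive-asym : ∀ {l x y} → Unique l → Consecutive l x y → Consecutive l y x → ⊥
  consecutive-asym ((x≢y ∷ _) ∷ _) here here = x≢y refl
  consecutive-asym (x∉ ∷ _) here (there c) = All¬⇒¬Any x∉ (there (consecutive-∈-tail c))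
  consecutive-asym (x∉ ∷ _) (there c) here = All¬⇒¬Any x∉ (there (consecutive-∈-tail c))
  consecutive-asym (_ ∷ u) (there c) (there c′) = consecutive-asym u c c′

  last-∈ : ∀ {l : List X} {t} → last l ≡ just t → t ∈ l
  last-∈ {x ∷ []} refl = here refl
  last-∈ {x ∷ y ∷ l} e = there (last-∈ {y ∷ l} e)

  nothing-before-head : ∀ {l : List X} {s x} → Unique l → head l ≡ just s → ¬ Consecutive l x s
  nothing-before-head (s∉ ∷ _) refl c = All¬⇒¬Any s∉ (consecutive-∈-tail c)

  nothing-after-last : ∀ {l : List X} {t y} → Unique l → last l ≡ just t → ¬ Consecutive l t y
  nothing-after-last {x ∷ y ∷ l} (t∉ ∷ _) e here = All¬⇒¬Any t∉ (last-∈ {y ∷ l} e)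
  nothing-after-last {x ∷ y ∷ l} (_ ∷ u) e (there c) = nothing-after-last u e c

  successor-exists : ∀ {l : List X} {t x} → last l ≡ just t → x ∈ l → x ≢ t → ∃ (Consecutive l x)
  successor-exists {x ∷ []} refl (here refl) x≢t = ⊥-elim (x≢t refl)
  successor-exists {x ∷ y ∷ l} e (here refl) x≢t = y , here
  successor-exists {x ∷ y ∷ l} e (there x∈) x≢t with successor-exists {y ∷ l} e x∈ x≢t
  ... | z , c = z , there c

  predecessor-exists : ∀ {l : List X} {s y} → head l ≡ just s → y ∈ l → y ≢ s → ∃ λ x → Consecutive l x y
  predecessor-exists refl (here refl) y≢s = ⊥-elim (y≢s refl)
  predecessor-exists {x ∷ l} refl (there y∈) y≢s = predecessor-in-tail y∈
    where
    predecessor-in-tail : ∀ {x} {l : List X} {y} → y ∈ l → ∃ λ z → Consecutive (x ∷ l) z y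
    predecessor-in-tail {x} {y ∷ l} (here refl) = x , here
    predecessor-in-tail {x} {y ∷ l} (there y∈) with predecessor-in-tail {y} {l} y∈
    ... | z , c = z , there c

  ∈-─ : ∀ {x y} {l : List X} (x∈ : x ∈ l) → y ∈ l → y ≢ x → y ∈ (l ─ x∈)
  ∈-─ (here refl) (here refl) y≢x = ⊥-elim (y≢x refl)
  ∈-─ (here _) (there y∈) _ = y∈
  ∈-─ (there _) (here e) _ = here e
  ∈-─ (there x∈) (there y∈) y≢x = there (∈-─ x∈ y∈ y≢x)

  unique-⊆⇒length-≤ : ∀ ws l → Unique ws → All (_∈ l) ws → length ws ≤ length l
  unique-⊆⇒length-≤ [] l _ _ = z≤n
  unique-⊆⇒length-≤ (w ∷ ws) l (w∉ ∷ u) (w∈ ∷ ws⊆) =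
    subst (suc (length ws) ≤_) (sym (length-removeAt′ l (index w∈)))
      (s≤s (unique-⊆⇒length-≤ ws (l ─ w∈) u (still-in w∉ ws⊆)))
    where
    still-in : ∀ {vs} → All (λ v → ¬ w ≡ v) vs → All (_∈ l) vs → All (_∈ (l ─ w∈)) vs
    still-in [] [] = []
    still-in (w≢v ∷ ns) (v∈ ∷ vs⊆) = ∈-─ w∈ v∈ (λ e → w≢v (sym e)) ∷ still-in ns vs⊆

  consecutive-from-head : ∀ {x y} {r : List X} → Unique (x ∷ r) → Consecutive (x ∷ r) x y → ∃ λ r′ → r ≡ y ∷ r′
  consecutive-from-head _ here = _ , refl
  consecutive-from-head (x∉ ∷ _) (there c) = ⊥-elim (All¬⇒¬Any x∉ (consecutive-∈ˡ c))

  consecutive-in-tail : ∀ {z x y} {l : List X} → Unique (z ∷ l) → x ∈ l → Consecutive (z ∷ l) x y → Consecutive l x y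
  consecutive-in-tail (z∉ ∷ _) x∈ here = ⊥-elim (All¬⇒¬Any z∉ x∈)
  consecutive-in-tail _ _ (there c) = c

  unique-tail : ∀ {x} {l : List X} → Unique (x ∷ l) → Unique l
  unique-tail (_ ∷ u) = u

  last-of-unique : ∀ {t} {r : List X} → Unique (t ∷ r) → last (t ∷ r) ≡ just t → r ≡ []
  last-of-unique {r = []} _ _ = refl
  last-of-unique {r = y ∷ r} (t∉ ∷ _) e = ⊥-elim (All¬⇒¬Any t∉ (last-∈ {y ∷ r} e))

  length≡1 : ∀ {l : List X} {s} → Unique l → head l ≡ just s → last l ≡ just s → length l ≡ 1
  length≡1 {s ∷ r} u refl e with last-of-unique u e
  ... | refl = refl

  length≡3 : ∀ {l : List X} {s x t} → Unique l → head l ≡ just s → last l ≡ just t →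
             Consecutive l s x → Consecutive l x t → length l ≡ 3
  length≡3 {s ∷ r} u refl e c₁ c₂ with consecutive-from-head u c₁
  ... | _ , refl with consecutive-from-head (unique-tail u) (consecutive-in-tail u (here refl) c₂)
  ... | _ , refl with last-of-unique (unique-tail (unique-tail u)) e
  ... | refl = refl

  length≡5 : ∀ {l : List X} {s x y z t} → Unique l → head l ≡ just s → last l ≡ just t →
             Consecutive l s x → Consecutive l x y → Consecutive l y z → Consecutive l z t → length l ≡ 5
  length≡5 {s ∷ r} u refl e c₁ c₂ c₃ c₄ with consecutive-from-head u c₁
  ... | _ , refl with consecutive-from-head u₁ (consecutive-in-tail u (here refl) c₂)
    where u₁ = unique-tail u
  ... | _ , refl with consecutive-from-head u₂ (consecutive-in-tail u₁ (here refl) (consecutive-in-tail u (there (here refl)) c₃))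
    where u₁ = unique-tail u; u₂ = unique-tail u₁
  ... | _ , refl with consecutive-from-head u₃ (consecutive-in-tail u₂ (here refl) (consecutive-in-tail u₁ (there (here refl)) (consecutive-in-tail u (there (there (here refl))) c₄)))
    where u₁ = unique-tail u; u₂ = unique-tail u₁; u₃ = unique-tail u₂
  ... | _ , refl with last-of-unique (unique-tail (unique-tail (unique-tail (unique-tail u)))) e
  ... | refl = refl

-- Forcing a Hamiltonian path through the blocks

-- The last three fields hold because a Hamiltonian path has at least six vertices.
record PathSuccessor (p : Parity) (K : ℕ) (s t : Vertex) : Set₁ where
  field
    Next : Vertex → Vertex → Set
    next-arc : ∀ {x y} → Next x y → Arc p K x y
    next-functional : ∀ {x y z} → Next x y → Next x z → y ≡ z
    next-injective : ∀ {x y z} → Next x y → Next z y → x ≡ z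
    next-asym : ∀ {x y} → Next x y → Next y x → ⊥
    nothing-before-start : ∀ {x} → ¬ Next x s
    nothing-after-end : ∀ {y} → ¬ Next t y
    next-exists : ∀ {x} → IsVertex p K x → x ≢ t → ∃ (Next x)
    previous-exists : ∀ {y} → IsVertex p K y → y ≢ s → ∃ λ x → Next x y
    start≢end : s ≢ t
    not-two-steps : ∀ {x} → Next s x → Next x t → ⊥
    not-four-steps : ∀ {x y z} → Next s x → Next x y → Next y z → Next z t → ⊥

module Forcing {p K' s t} (P : PathSuccessor p (suc K') s t) (s-BD : IsBD s) (t-BD : IsBD t) where

  open PathSuccessor P

  K : ℕ
  K = suc K'

  1≤K : 1 ≤ K
  1≤K = s≤s z≤n

  A≢t : ∀ {i} → A i ≢ t
  A≢t e = case subst IsBD (sym e) t-BD of λ ()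
  C≢t : ∀ {i} → C i ≢ t
  C≢t e = case subst IsBD (sym e) t-BD of λ ()
  A≢s : ∀ {i} → A i ≢ s
  A≢s e = case subst IsBD (sym e) s-BD of λ ()
  C≢s : ∀ {i} → C i ≢ s
  C≢s e = case subst IsBD (sym e) s-BD of λ ()

  nothing-after : ∀ {u y} → u ≡ t → Next u y → ⊥
  nothing-after refl = nothing-after-end
  nothing-before : ∀ {u x} → s ≡ u → Next x u → ⊥
  nothing-before refl = nothing-before-start

  -- Only the extra arc C K → D 1 of odd k leaves a block from its C vertex.
  CLocal : ℕ → Set
  CLocal l = ∀ {y} → Next (C l) y → y ≡ B l ⊎ y ≡ D l

  DFromC : ℕ → Set
  DFromC l = ∀ {x} → Next x (D l) → x ≡ C l

  c-local : ∀ {l} → (l < K ⊎ p ≡ even) → CLocal l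
  c-local h sy = from-C-interior h (next-arc sy)

  forward-block : ∀ {j} → suc j ≤ K → CLocal (suc j) → B (suc j) ≢ s → B (suc j) ≢ t → D (suc j) ≢ t →
        Next (D j) (A (suc j)) →
        Next (A (suc j)) (B (suc j)) × Next (B (suc j)) (C (suc j)) × Next (C (suc j)) (D (suc j)) × Next (D (suc j)) (A (suc (suc j)))
  forward-block {j} le co bs bt dt h with next-exists (v-B (s≤s z≤n) le) bt
  ... | y , sby with from-B (next-arc sby)
  ... | inj₁ refl = ⊥-elim (case next-injective h sby of λ ())
  ... | inj₂ refl with previous-exists (v-B (s≤s z≤n) le) bs
  ... | x , sxb with into-B le (next-arc sxb)
  ... | inj₂ refl = ⊥-elim (next-asym sxb sby)
  ... | inj₁ refl with next-exists (v-C (s≤s z≤n) le) C≢t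
  ... | y2 , scy with co scy
  ... | inj₁ refl = ⊥-elim (next-asym sby scy)
  ... | inj₂ refl with next-exists (v-D (s≤s z≤n) le) dt
  ... | y3 , sdy with from-D (next-arc sdy)
  ... | inj₁ refl = ⊥-elim (next-asym scy sdy)
  ... | inj₂ refl = sxb , sby , scy , sdy

  end≢B : ∀ {l} → 1 ≤ l → l ≤ K → CLocal l → DFromC l → D l ≢ s → t ≡ B l → ⊥
  end≢B {l} l1 le co ne ds tb with previous-exists (v-C l1 le) C≢s
  ... | x , sxc with into-C (next-arc sxc)
  ... | inj₁ refl = nothing-after (sym tb) sxc
  ... | inj₂ refl with next-exists (v-C l1 le) C≢t
  ... | y , scy with co scy
  ... | inj₂ refl = next-asym sxc scy
  ... | inj₁ refl with previous-exists (v-D l1 le) ds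
  ... | z , szd with ne szd
  ... | refl = case next-functional scy szd of λ ()

  end≢D-forward : ∀ {j} → suc (suc j) ≤ K → B (suc j) ≢ s → B (suc (suc j)) ≢ s → D (suc (suc j)) ≢ s →
       Next (D j) (A (suc j)) → t ≡ D (suc j) → ⊥
  end≢D-forward {j} lt bs bs' ds' h td with next-exists (v-A (s≤s z≤n) (<⇒≤ lt)) A≢t
  ... | y , say with from-A-interior lt (next-arc say)
  ... | inj₂ refl = bcase
    where
    bcase : ⊥
    bcase with previous-exists (v-B (s≤s z≤n) (<⇒≤ lt)) bs
    ... | x , sxb with into-B (<⇒≤ lt) (next-arc sxb)
    ... | inj₁ refl = case next-functional say sxb of λ ()
    ... | inj₂ refl with next-exists (v-B (s≤s z≤n) (<⇒≤ lt)) (λ e → case trans e td of λ ())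
    ... | y2 , sby with from-B (next-arc sby)
    ... | inj₁ refl = case next-injective h sby of λ ()
    ... | inj₂ refl = next-asym sxb sby
  ... | inj₁ refl = acase
    where
    acase : ⊥
    acase with previous-exists (v-D (s≤s z≤n) lt) ds'
    ... | x , sxd with into-D-interior (s≤s z≤n) (next-arc sxd)
    ... | inj₂ refl = case next-functional say sxd of λ ()
    ... | inj₁ refl with previous-exists (v-C (s≤s z≤n) lt) C≢s
    ... | x2 , sxc with into-C (next-arc sxc)
    ... | inj₂ refl = next-asym sxd sxc
    ... | inj₁ refl with previous-exists (v-B (s≤s z≤n) lt) bs'
    ... | x3 , sxb with into-B lt (next-arc sxb)
    ... | inj₂ refl = next-asym sxc sxb
    ... | inj₁ refl with previous-exists (v-A (s≤s z≤n) lt) A≢s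
    ... | x4 , sxa with into-A (next-arc sxa)
    ... | inj₁ refl = next-asym sxb sxa
    ... | inj₂ refl = nothing-after (sym td) sxa

  backward-block : ∀ {l z} → 1 ≤ l → l ≤ K → CLocal l → B l ≢ s → B l ≢ t → Next z (D l) → z ≢ C l →
        Next (D l) (C l) × Next (C l) (B l) × Next (B l) (A l)
  backward-block {l} l1 le co bs bt szd zc with next-exists (v-C l1 le) C≢t
  ... | y , scy with co scy
  ... | inj₂ refl = ⊥-elim (zc (sym (next-injective scy szd)))
  ... | inj₁ refl with previous-exists (v-C l1 le) C≢s
  ... | x , sxc with into-C (next-arc sxc)
  ... | inj₁ refl = ⊥-elim (next-asym sxc scy)
  ... | inj₂ refl with next-exists (v-B l1 le) bt
  ... | y2 , sby with from-B (next-arc sby)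
  ... | inj₂ refl = ⊥-elim (next-asym scy sby)
  ... | inj₁ refl = sxc , scy , sby

  backward-last-block-odd : p ≡ odd → B K ≢ s → B K ≢ t → D K ≢ t →
        Next (D K) (C K) × Next (C K) (B K) × Next (B K) (A K)
  backward-last-block-odd refl bs bt dt with next-exists (v-D 1≤K ≤-refl) dt
  ... | y , sdy with from-D-last-odd 1≤K (next-arc sdy)
  ... | refl with next-exists (v-B 1≤K ≤-refl) bt
  ... | y2 , sby with from-B (next-arc sby)
  ... | inj₂ refl = ⊥-elim (case next-injective sdy sby of λ ())
  ... | inj₁ refl with previous-exists (v-B 1≤K ≤-refl) bs
  ... | x , sxb with into-B ≤-refl (next-arc sxb)
  ... | inj₁ refl = ⊥-elim (next-asym sxb sby)
  ... | inj₂ refl = sdy , sxb , sby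

  end≢B-backward : ∀ {j} → suc j ≤ K → Next (D j) (C j) → t ≡ B (suc j) → ⊥
  end≢B-backward {j} le h tb with previous-exists (v-A (s≤s z≤n) le) A≢s
  ... | x , sxa with into-A (next-arc sxa)
  ... | inj₁ refl = nothing-after (sym tb) sxa
  ... | inj₂ refl = case next-functional h sxa of λ ()

  end≢D-backward : ∀ {l z} → 1 ≤ l → l ≤ K → CLocal l → Next z (D l) → z ≢ C l → t ≡ D l → ⊥
  end≢D-backward {l} l1 le co szd zc td with previous-exists (v-C l1 le) C≢s
  ... | x , sxc with into-C (next-arc sxc)
  ... | inj₂ refl = nothing-after (sym td) sxc
  ... | inj₁ refl with next-exists (v-C l1 le) C≢t
  ... | y , scy with co scy
  ... | inj₁ refl = next-asym sxc scy
  ... | inj₂ refl = zc (sym (next-injective scy szd))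

  StartOutside : ℕ → ℕ → Set
  StartOutside j e = ∀ l → j < l → l ≤ e → B l ≢ s × D l ≢ s

  shift-sum : ∀ j d e → j + suc d ≡ e → suc j + d ≡ e
  shift-sum j d e eq = trans (sym (+-suc j d)) eq

  ≤-of-sum : ∀ j d e → suc j + d ≡ e → suc j ≤ e
  ≤-of-sum j d e eq = subst (suc j ≤_) eq (m≤m+n (suc j) d)

  dFromC-after-AB : ∀ {l} → 1 ≤ l → Next (A l) (B l) → DFromC (suc l)
  dFromC-after-AB {l} l1 sab sxd with into-D-interior l1 (next-arc sxd)
  ... | inj₁ e = e
  ... | inj₂ refl = case next-functional sab sxd of λ ()

  data ForwardSweep (e : ℕ) : Set where
    stops-at : ∀ {j} → suc j ≡ e → t ≡ D e → Next (D j) (A (suc j)) → ForwardSweep e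
    passes : Next (D e) (A (suc e)) → DFromC (suc e) → ForwardSweep e

  sweep-forward-end : ∀ d j e → suc j + d ≡ e → e < K → StartOutside j e → Next (D j) (A (suc j)) → t ≡ D (suc j) →
                      ForwardSweep e
  sweep-forward-end zero j e eq' lt fr h td with trans (sym (+-identityʳ (suc j))) eq'
  ... | refl = stops-at refl td h
  sweep-forward-end (suc d) j e eq' lt fr h td = ⊥-elim (end≢D-forward lt2 (proj₁ fr1) (proj₁ fr2) (proj₂ fr2) h td)
    where
    lle1 : suc j ≤ e
    lle1 = ≤-of-sum j (suc d) e eq'
    lle2 : suc (suc j) ≤ e
    lle2 = subst (suc (suc j) ≤_) eq' (subst (suc (suc j) ≤_) (sym (+-suc (suc j) d)) (m≤m+n (suc (suc j)) d))
    lt2 : suc (suc j) ≤ K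
    lt2 = <⇒≤ (≤-<-trans lle2 lt)
    fr1 = fr (suc j) ≤-refl lle1
    fr2 = fr (suc (suc j)) (s≤s (n≤1+n j)) lle2

  sweep-forward : ∀ d j e → j + d ≡ e → e < K → StartOutside j e → Next (D j) (A (suc j)) → DFromC (suc j) →
                  ForwardSweep e
  sweep-forward zero j e eq lt fr h ne with trans (sym (+-identityʳ j)) eq
  ... | refl = passes h ne
  sweep-forward (suc d) j e eq lt fr h ne with shift-sum j d e eq
  ... | eq' with ≤-of-sum j d e eq'
  ... | lle with ≤-<-trans lle lt
  ... | llt with fr (suc j) ≤-refl lle
  ... | bs , ds with t ≟ᵥ D (suc j)
  ... | yes td = sweep-forward-end d j e eq' lt fr h td
  ... | no tnd with t ≟ᵥ B (suc j)
  ... | yes tb = ⊥-elim (end≢B (s≤s z≤n) (<⇒≤ llt) (c-local (inj₁ llt)) ne ds tb)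
  ... | no tnb with forward-block (<⇒≤ llt) (c-local (inj₁ llt)) bs (λ e → tnb (sym e)) (λ e → tnd (sym e)) h
  ... | sab , sbc , scd , sda = sweep-forward d (suc j) e eq' lt (λ l a b → fr l (<⇒≤ a) b) sda (dFromC-after-AB (s≤s z≤n) sab)

  sweep-backward : ∀ d j e → j + d ≡ e → e < K → StartOutside j e → Next (A j) (D (suc j)) → Next (D j) (C j) →
          Next (A e) (D (suc e)) × Next (D e) (C e)
  sweep-backward zero j e eq lt fr h hdc with trans (sym (+-identityʳ j)) eq
  ... | refl = h , hdc
  sweep-backward (suc d) j e eq lt fr h hdc with shift-sum j d e eq
  ... | eq' with ≤-of-sum j d e eq'
  ... | lle with ≤-<-trans lle lt
  ... | llt with fr (suc j) ≤-refl lle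
  ... | bs , ds with t ≟ᵥ D (suc j)
  ... | yes td = ⊥-elim (end≢D-backward (s≤s z≤n) (<⇒≤ llt) (c-local (inj₁ llt)) h (λ ()) td)
  ... | no tnd with t ≟ᵥ B (suc j)
  ... | yes tb = ⊥-elim (end≢B-backward (<⇒≤ llt) hdc tb)
  ... | no tnb with backward-block (s≤s z≤n) (<⇒≤ llt) (c-local (inj₁ llt)) bs (λ e → tnb (sym e)) h (λ ())
  ... | sdc , scb , sba with next-exists (v-A (s≤s z≤n) (<⇒≤ llt)) A≢t
  ... | y , say with from-A-interior llt (next-arc say)
  ... | inj₁ refl = ⊥-elim (next-asym sba say)
  ... | inj₂ refl = sweep-backward d (suc j) e eq' lt (λ l a b → fr l (<⇒≤ a) b) say sdc

  backward-B-A : ∀ {l z} → 1 ≤ l → l ≤ K → B l ≢ s → B l ≢ t → D l ≢ t → Next z (D l) → z ≢ C l → Next (B l) (A l)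
  backward-B-A l1 le bs bt dt szd zc with m≤n⇒m<n∨m≡n le
  ... | inj₁ lt = proj₂ (proj₂ (backward-block l1 le (c-local (inj₁ lt)) bs bt szd zc))
  ... | inj₂ refl with parity-cases p
  ... | inj₁ po = proj₂ (proj₂ (backward-last-block-odd po bs bt dt))
  ... | inj₂ pe = proj₂ (proj₂ (backward-block l1 le (c-local (inj₂ pe)) bs bt szd zc))

  not-two-steps′ : ∀ {u x w} → Next u x → Next x w → u ≡ s → w ≡ t → ⊥
  not-two-steps′ a b refl refl = not-two-steps a b

  not-four-steps′ : ∀ {u a b c w} → Next u a → Next a b → Next b c → Next c w → u ≡ s → w ≡ t → ⊥
  not-four-steps′ p₁ p₂ p₃ p₄ refl refl = not-four-steps p₁ p₂ p₃ p₄

  no-arc-C-D1-from-B : ∀ i' → s ≡ B (suc i') → t ≡ D (suc (suc i')) → Next (C (suc i')) (D (suc i')) →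
                       suc (suc i') ≡ K → Next (C (suc (suc i'))) (D 1) → ⊥
  no-arc-C-D1-from-B zero _ _ scd _ sck = case next-injective scd sck of λ ()
  no-arc-C-D1-from-B (suc i') hs td scd eK sck
    with backward-block (s≤s z≤n) 1≤K (c-local (inj₁ (subst (2 ≤_) eK (s≤s (s≤s z≤n)))))
           (λ e → case trans e hs of λ ()) (λ e → case trans e td of λ ()) sck (λ ())
  ... | _ , _ , sba with next-exists (v-D0 {p} {K}) (λ e → case trans e td of λ ())
  ... | y , sdy with from-D0 (next-arc sdy)
  ... | refl = case next-injective sba sdy of λ ()

  end≢D-from-B : ∀ {i'} → suc (suc i') ≤ K → s ≡ B (suc i') → t ≡ D (suc (suc i')) →
                 Next (C (suc i')) (D (suc i')) → Next (A (suc i')) (D (suc (suc i'))) → ⊥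
  end≢D-from-B {i'} lt hs td scd sad with previous-exists (v-C (s≤s z≤n) lt) C≢s
  ... | x , sxc with into-C (next-arc sxc)
  ... | inj₂ refl = nothing-after (sym td) sxc
  ... | inj₁ refl with next-exists (v-C (s≤s z≤n) lt) C≢t
  ... | y , scy with from-C (next-arc scy)
  ... | inj₁ refl = next-asym sxc scy
  ... | inj₂ (inj₁ refl) = case next-injective sad scy of λ ()
  ... | inj₂ (inj₂ (refl , eK , refl)) = no-arc-C-D1-from-B i' hs td scd eK scy

  end-from-B : ∀ {i'} → suc (suc i') ≤ K → s ≡ B (suc i') → t ≡ B (suc (suc i'))
  end-from-B {i'} lt hs with previous-exists (v-C (s≤s z≤n) (<⇒≤ lt)) C≢s
  ... | x , sxc with next-exists (v-C (s≤s z≤n) (<⇒≤ lt)) C≢t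
  ... | y , scy with c-local (inj₁ lt) scy
  ... | inj₁ refl = ⊥-elim (nothing-before hs scy)
  ... | inj₂ refl with into-C (next-arc sxc)
  ... | inj₂ refl = ⊥-elim (next-asym sxc scy)
  ... | inj₁ refl with next-exists (v-A (s≤s z≤n) (<⇒≤ lt)) A≢t
  ... | y2 , say with from-A-interior lt (next-arc say)
  ... | inj₁ refl = ⊥-elim (nothing-before hs say)
  ... | inj₂ refl with t ≟ᵥ B (suc (suc i'))
  ... | yes tb = tb
  ... | no tnb with t ≟ᵥ D (suc (suc i'))
  ... | yes td = ⊥-elim (end≢D-from-B lt hs td scy say)
  ... | no tnd with backward-B-A (s≤s z≤n) lt (λ e → case trans e hs of λ ()) (λ e → tnb (sym e)) (λ e → tnd (sym e)) say (λ ())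
  ... | sba with t ≟ᵥ D (suc i')
  ... | yes td' = ⊥-elim (not-two-steps′ sxc scy (sym hs) (sym td'))
  ... | no tnd' with next-exists (v-D (s≤s z≤n) (<⇒≤ lt)) (λ e → tnd' (sym e))
  ... | y5 , sdy with from-D (next-arc sdy)
  ... | inj₁ refl = ⊥-elim (next-asym scy sdy)
  ... | inj₂ refl = ⊥-elim (case next-injective sba sdy of λ ())

  v-X′ : p ≡ even → IsVertex p K (A (suc K))
  v-X′ refl = v-X
  v-Y′ : p ≡ even → IsVertex p K (B (suc K))
  v-Y′ refl = v-Y

  next-arc-odd : ∀ {x y} → p ≡ odd → Next x y → Arc odd K x y
  next-arc-odd refl e = next-arc e
  next-arc-even : ∀ {x y} → p ≡ even → Next x y → Arc even K x y
  next-arc-even refl e = next-arc e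

  D≢D0 : ∀ {l} → 0 < l → D l ≢ D 0
  D≢D0 (s≤s _) ()

  ≢start : ∀ {u v} → s ≡ v → u ≢ v → u ≢ s
  ≢start hs ne e = ne (trans e hs)
  ≢end : ∀ {u v} → t ≡ v → u ≢ v → u ≢ t
  ≢end ht ne e = ne (trans e ht)

  end≢B1-from-D0-odd : p ≡ odd → 1 ≤ K' → s ≡ D 0 → t ≡ B 1 → ⊥
  end≢B1-from-D0-odd po 1≤K' hs tb with previous-exists (v-C (s≤s z≤n) 1≤K) C≢s
  ... | x , sxc with into-C (next-arc sxc)
  ... | inj₁ refl = nothing-after (sym tb) sxc
  ... | inj₂ refl with next-exists (v-C (s≤s z≤n) 1≤K) C≢t
  ... | y , scy with c-local (inj₁ (s≤s 1≤K')) scy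
  ... | inj₂ refl = next-asym sxc scy
  ... | inj₁ refl with previous-exists (v-D (s≤s z≤n) 1≤K) (≢start hs (λ ()))
  ... | x2 , sxd with into-D1-odd (next-arc-odd po sxd)
  ... | inj₁ refl = case next-functional scy sxd of λ ()
  ... | inj₂ refl with next-exists (v-D 1≤K ≤-refl) (≢end tb (λ ()))
  ... | y2 , sdy with from-D-last-odd 1≤K (next-arc-odd po sdy)
  ... | refl with previous-exists (v-B 1≤K ≤-refl) (≢start hs (λ ()))
  ... | x3 , sxb with into-B ≤-refl (next-arc sxb)
  ... | inj₂ refl = case next-functional sxd sxb of λ ()
  ... | inj₁ refl with next-exists (v-B 1≤K ≤-refl) (≢end tb (λ { refl → case 1≤K' of λ () }))
  ... | y3 , sby with from-B (next-arc sby)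
  ... | inj₁ refl = next-asym sxb sby
  ... | inj₂ refl = case next-injective sdy sby of λ ()

  c-local-last : 1 ≤ K' → Next (C 1) (D 1) → CLocal K
  c-local-last 1≤K' scd sy with from-C (next-arc sy)
  ... | inj₁ e = inj₁ e
  ... | inj₂ (inj₁ e) = inj₂ e
  ... | inj₂ (inj₂ (_ , _ , refl)) = case next-injective scd sy of λ { refl → case 1≤K' of λ () }

  end-from-D0-odd : p ≡ odd → 1 ≤ K' → s ≡ D 0 → t ≡ D K
  end-from-D0-odd po 1≤K' hs with next-exists v-D0 (λ e → start≢end (trans hs e))
  ... | y , sdy with from-D0 (next-arc sdy)
  ... | refl with t ≟ᵥ B 1
  ... | yes tb1 = ⊥-elim (end≢B1-from-D0-odd po 1≤K' hs tb1)
  ... | no tnb1 with t ≟ᵥ D 1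
  ... | yes td1 = ⊥-elim (end≢D-forward {0} (s≤s 1≤K') (≢start hs (λ ())) (≢start hs (λ ())) (≢start hs (λ ())) sdy td1)
  ... | no tnd1 with forward-block {0} (s≤s z≤n) (c-local (inj₁ (s≤s 1≤K'))) (≢start hs (λ ())) (λ e → tnb1 (sym e)) (λ e → tnd1 (sym e)) sdy
  ... | sab , sbc , scd , sda1 with sweep-forward (K' ∸ 1) 1 K' (m+[n∸m]≡n 1≤K') ≤-refl
                                  (λ l a b → ≢start hs (λ ()) , ≢start hs (D≢D0 (≤-trans (s≤s z≤n) a)))
                                  sda1 (dFromC-after-AB (s≤s z≤n) sab)
  ... | stops-at {j'} refl td' h' = ⊥-elim (end≢D-forward {j'} ≤-refl (≢start hs (λ ())) (≢start hs (λ ())) (≢start hs (λ ())) h' td')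
  ... | passes sdK neK with t ≟ᵥ D K
  ... | yes tdK = tdK
  ... | no tndK with t ≟ᵥ B K
  ... | yes tbK = ⊥-elim (end≢B 1≤K ≤-refl (c-local-last 1≤K' scd) neK (≢start hs (λ ())) tbK)
  ... | no tnbK with forward-block {K'} ≤-refl (c-local-last 1≤K' scd) (≢start hs (λ ())) (λ e → tnbK (sym e)) (λ e → tndK (sym e)) sdK
  ... | _ , _ , _ , sda = ⊥-elim (case from-D-last-odd 1≤K (next-arc-odd po sda) of λ ())

  no-arc-B-C-last-odd : p ≡ odd → 1 ≤ K' → s ≡ B K → ¬ Next (B K) (C K)
  no-arc-B-C-last-odd po 1≤K' hs sbc with next-exists (v-A 1≤K ≤-refl) A≢t
  ... | y , say with from-A-last-odd (next-arc-odd po say)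
  ... | inj₁ refl = nothing-before hs say
  ... | inj₂ refl with t ≟ᵥ D K
  ... | no tnd with next-exists (v-D 1≤K ≤-refl) (λ e → tnd (sym e))
  ... | y′ , sdy with from-D-last-odd 1≤K (next-arc-odd po sdy)
  ... | refl = case next-injective sdy sbc of λ ()
  no-arc-B-C-last-odd po 1≤K' hs sbc | y , say | inj₂ refl | yes tdK with next-exists (v-C 1≤K ≤-refl) C≢t
  ... | y′ , scy with from-C (next-arc scy)
  ... | inj₁ refl = nothing-before hs scy
  ... | inj₂ (inj₁ refl) = not-two-steps′ sbc scy (sym hs) (sym tdK)
  ... | inj₂ (inj₂ (_ , _ , refl))
    with backward-block (s≤s z≤n) 1≤K (c-local (inj₁ (s≤s 1≤K'))) (≢start hs (λ { refl → case 1≤K' of λ () }))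
           (≢end tdK (λ ())) scy (λ { refl → case 1≤K' of λ () })
  ... | _ , _ , sba with next-exists v-D0 (≢end tdK (λ ()))
  ... | y″ , sd0 with from-D0 (next-arc sd0)
  ... | refl = case next-injective sba sd0 of λ ()

  end≢D1-after-C-last : 1 ≤ K' → t ≡ D 1 → ¬ Next (C K) (D 1)
  end≢D1-after-C-last 1≤K' td1 scd with previous-exists (v-C (s≤s z≤n) 1≤K) C≢s
  ... | x , sxc with into-C (next-arc sxc)
  ... | inj₂ refl = nothing-after (sym td1) sxc
  ... | inj₁ refl with next-exists (v-C (s≤s z≤n) 1≤K) C≢t
  ... | y , scy with c-local (inj₁ (s≤s 1≤K')) scy
  ... | inj₁ refl = next-asym sxc scy
  ... | inj₂ refl = case next-injective scd scy of λ { refl → case 1≤K' of λ () }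

  end-from-B-last-odd : p ≡ odd → 1 ≤ K' → s ≡ B K → t ≡ B 1
  end-from-B-last-odd po 1≤K' hs with next-exists (v-B 1≤K ≤-refl) (λ e → start≢end (trans hs e))
  ... | y , sby with from-B (next-arc sby)
  ... | inj₂ refl = ⊥-elim (no-arc-B-C-last-odd po 1≤K' hs sby)
  ... | inj₁ refl with previous-exists (v-C 1≤K ≤-refl) C≢s
  ... | x , sxc with into-C (next-arc sxc)
  ... | inj₁ refl = ⊥-elim (case next-functional sby sxc of λ ())
  ... | inj₂ refl with next-exists (v-C 1≤K ≤-refl) C≢t
  ... | y1 , scy with from-C (next-arc scy)
  ... | inj₁ refl = ⊥-elim (nothing-before hs scy)
  ... | inj₂ (inj₁ refl) = ⊥-elim (next-asym sxc scy)
  ... | inj₂ (inj₂ (_ , _ , refl)) with next-exists (v-A 1≤K ≤-refl) A≢t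
  ... | y2 , say with from-A-last-odd (next-arc-odd po say)
  ... | inj₁ refl = ⊥-elim (next-asym sby say)
  ... | inj₂ refl with t ≟ᵥ D 0
  ... | yes td0 = ⊥-elim (not-two-steps′ sby say (sym hs) (sym td0))
  ... | no tnd0 with next-exists v-D0 (λ e → tnd0 (sym e))
  ... | y3 , sd0 with from-D0 (next-arc sd0)
  ... | refl with t ≟ᵥ B 1
  ... | yes tb1 = tb1
  ... | no tnb1 with t ≟ᵥ D 1
  ... | yes td1 = ⊥-elim (end≢D1-after-C-last 1≤K' td1 scy)
  ... | no tnd1 with forward-block {0} 1≤K (c-local (inj₁ (s≤s 1≤K'))) (≢start hs (λ { refl → case 1≤K' of λ () })) (λ e → tnb1 (sym e)) (λ e → tnd1 (sym e)) sd0
  ... | _ , _ , scd1 , _ = ⊥-elim (case next-injective scy scd1 of λ { refl → case 1≤K' of λ () })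

  D≢< : ∀ {l i} → l < i → D l ≢ D i
  D≢< lt refl = n≮n _ lt
  D≢> : ∀ {l i} → i < l → D l ≢ D i
  D≢> lt refl = n≮n _ lt

  dFromC-1-odd : p ≡ odd → Next (C K) (B K) → DFromC 1
  dFromC-1-odd po scb sxd with into-D1-odd (next-arc-odd po sxd)
  ... | inj₁ e = e
  ... | inj₂ refl = case next-functional scb sxd of λ ()

  dFromC-1-even : p ≡ even → Next (A (suc K)) (D 0) → DFromC 1
  dFromC-1-even pe sxd₀ sxd with into-D1-even (next-arc-even pe sxd)
  ... | inj₁ e = e
  ... | inj₂ refl = case next-functional sxd₀ sxd of λ ()

  no-arc-X-D1-even : p ≡ even → D 0 ≢ s → ¬ Next (A (suc K)) (D 1)
  no-arc-X-D1-even pe d₀≢s sxd₁ with previous-exists v-D0 d₀≢s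
  ... | x , sxd with into-D0-even (next-arc-even pe sxd)
  ... | refl = case next-functional sxd₁ sxd of λ ()

  end≢Y-even : p ≡ even → t ≡ B (suc K) → ¬ Next (D K) (C K)
  end≢Y-even pe ty sdc with previous-exists (v-X′ pe) A≢s
  ... | x , sxX with into-A {j = K} (next-arc sxX)
  ... | inj₁ refl = nothing-after (sym ty) sxX
  ... | inj₂ refl = case next-functional sdc sxX of λ ()

  end-via-D0 : ∀ i' → suc i' ≤ K → s ≡ D (suc i') → DFromC 1 → Next (B (suc i')) (A (suc i')) → t ≡ D i'
  end-via-D0 i' le hs dFromC-1 sba with t ≟ᵥ D 0
  end-via-D0 zero le hs dFromC-1 sba | yes td0 = td0
  end-via-D0 (suc i'') le hs dFromC-1 sba | yes td0 = ⊥-elim end≢D0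
    where
    end≢D0 : ⊥
    end≢D0 with previous-exists (v-A (s≤s z≤n) (s≤s z≤n)) A≢s
    ... | x , sxa with into-A {j = 0} (next-arc sxa)
    ... | inj₂ refl = nothing-after (sym td0) sxa
    ... | inj₁ refl with previous-exists (v-D (s≤s z≤n) (s≤s z≤n)) (≢start hs (λ ()))
    ... | x2 , sxd with dFromC-1 sxd
    ... | refl with previous-exists (v-B (s≤s z≤n) (s≤s z≤n)) (≢start hs (λ ()))
    ... | x3 , sxb with into-B (s≤s z≤n) (next-arc sxb)
    ... | inj₁ refl = next-asym sxb sxa
    ... | inj₂ refl = case next-functional sxd sxb of λ ()
  end-via-D0 i' le hs dFromC-1 sba | no tnd0 with next-exists v-D0 (λ e → tnd0 (sym e))
  ... | y , sd0 with from-D0 (next-arc sd0)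
  ... | refl = sweep-to-end i' le hs sba
    where
    sweep-to-end : ∀ i' → suc i' ≤ K → s ≡ D (suc i') → Next (B (suc i')) (A (suc i')) → t ≡ D i'
    sweep-to-end zero le hs sba = ⊥-elim (case next-injective sd0 sba of λ ())
    sweep-to-end (suc i'') le hs sba with sweep-forward (suc i'') 0 (suc i'') refl le
                                   (λ l a b → ≢start hs (λ ()) , ≢start hs (D≢< (s≤s b))) sd0 dFromC-1
    ... | stops-at _ td _ = td
    ... | passes h _ = ⊥-elim (case next-injective h sba of λ ())

  end≢D-last-backward : B K ≢ s → Next (A K') (D K) → Next (D K') (C K') → t ≡ D K → ⊥
  end≢D-last-backward bs sak sdc' tdK with previous-exists (v-C 1≤K ≤-refl) C≢s
  ... | x4 , sxc4 with into-C (next-arc sxc4)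
  ... | inj₂ refl = nothing-after (sym tdK) sxc4
  ... | inj₁ refl with previous-exists (v-B 1≤K ≤-refl) bs
  ... | x5 , sxb5 with into-B ≤-refl (next-arc sxb5)
  ... | inj₂ refl = next-asym sxc4 sxb5
  ... | inj₁ refl with previous-exists (v-A 1≤K ≤-refl) A≢s
  ... | x6 , sxa6 with into-A {j = K'} (next-arc sxa6)
  ... | inj₁ refl = next-asym sxb5 sxa6
  ... | inj₂ refl = case next-functional sdc' sxa6 of λ ()

  end-from-D-odd : p ≡ odd → ∀ i' → suc i' ≤ K' → s ≡ D (suc i') → t ≡ D i'
  end-from-D-odd po i' le hs with next-exists (v-C (s≤s z≤n) (≤-trans le (n≤1+n K'))) C≢t
  ... | y , scy with c-local (inj₁ (s≤s le)) scy
  ... | inj₂ refl = ⊥-elim (nothing-before hs scy)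
  ... | inj₁ refl with previous-exists (v-C (s≤s z≤n) (≤-trans le (n≤1+n K'))) C≢s
  ... | x , sxc with into-C (next-arc sxc)
  ... | inj₁ refl = ⊥-elim (next-asym sxc scy)
  ... | inj₂ refl with t ≟ᵥ B (suc i')
  ... | yes tb = ⊥-elim (not-two-steps′ sxc scy (sym hs) (sym tb))
  ... | no tnb with next-exists (v-B (s≤s z≤n) (≤-trans le (n≤1+n K'))) (λ e → tnb (sym e))
  ... | y2 , sby with from-B (next-arc sby)
  ... | inj₂ refl = ⊥-elim (next-asym scy sby)
  ... | inj₁ refl with next-exists (v-A (s≤s z≤n) (≤-trans le (n≤1+n K'))) A≢t
  ... | y3 , say with from-A-interior (s≤s le) (next-arc say)
  ... | inj₁ refl = ⊥-elim (next-asym sby say)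
  ... | inj₂ refl with sweep-backward (K' ∸ suc i') (suc i') K' (m+[n∸m]≡n le) ≤-refl
                      (λ l a b → ≢start hs (λ ()) , ≢start hs (D≢> a)) say sxc
  ... | sak , sdc' with t ≟ᵥ D K
  ... | yes tdK = ⊥-elim (end≢D-last-backward (≢start hs (λ ())) sak sdc' tdK)
  ... | no tndK with t ≟ᵥ B K
  ... | yes tbK = ⊥-elim (end≢B-backward {K'} ≤-refl sdc' tbK)
  ... | no tnbK with backward-last-block-odd po (≢start hs (λ ())) (λ e → tnbK (sym e)) (λ e → tndK (sym e))
  ... | _ , sckb , sbak with next-exists (v-A 1≤K ≤-refl) A≢t
  ... | y4 , sak0 with from-A-last-odd (next-arc-odd po sak0)
  ... | inj₁ refl = ⊥-elim (next-asym sbak sak0)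
  ... | inj₂ refl = end-via-D0 i' (m≤n⇒m≤1+n le) hs (dFromC-1-odd po sckb) sby

  end-from-D-last-odd : p ≡ odd → 1 ≤ K' → s ≡ D K → t ≡ D K'
  end-from-D-last-odd po 1≤K' hs with next-exists (v-D 1≤K ≤-refl) (λ e → start≢end (trans hs e))
  ... | y , sdy with from-D-last-odd 1≤K (next-arc-odd po sdy)
  ... | refl with next-exists (v-C 1≤K ≤-refl) C≢t
  ... | y1 , scy with from-C (next-arc scy)
  ... | inj₂ (inj₁ refl) = ⊥-elim (nothing-before hs scy)
  ... | inj₂ (inj₂ (_ , _ , refl)) = ⊥-elim no-arc-C-D1
    where
    no-arc-C-D1 : ⊥
    no-arc-C-D1 with previous-exists (v-B 1≤K ≤-refl) (≢start hs (λ ()))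
    ... | x , sxb with into-B ≤-refl (next-arc sxb)
    ... | inj₂ refl = case next-functional scy sxb of λ ()
    ... | inj₁ refl with previous-exists v-D0 (≢start hs (λ ()))
    ... | x2 , sxd with into-D0-odd (next-arc-odd po sxd)
    ... | refl = case next-functional sxb sxd of λ ()
  ... | inj₁ refl with t ≟ᵥ B K
  ... | yes tb = ⊥-elim (not-two-steps′ sdy scy (sym hs) (sym tb))
  ... | no tnb with next-exists (v-B 1≤K ≤-refl) (λ e → tnb (sym e))
  ... | y2 , sby with from-B (next-arc sby)
  ... | inj₂ refl = ⊥-elim (next-asym scy sby)
  ... | inj₁ refl with next-exists (v-A 1≤K ≤-refl) A≢t
  ... | y3 , say with from-A-last-odd (next-arc-odd po say)
  ... | inj₁ refl = ⊥-elim (next-asym sby say)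
  ... | inj₂ refl with t ≟ᵥ D 0
  ... | yes td0 = ⊥-elim (not-four-steps′ sdy scy sby say (sym hs) (sym td0))
  ... | no tnd0 with next-exists v-D0 (λ e → tnd0 (sym e))
  ... | y4 , sd0 with from-D0 (next-arc sd0)
  ... | refl with sweep-forward K' 0 K' refl ≤-refl (λ l a b → ≢start hs (λ ()) , ≢start hs (D≢< (s≤s b))) sd0 (dFromC-1-odd po scy)
  ... | stops-at _ td _ = td
  ... | passes h _ = ⊥-elim (case next-injective h sby of λ ())

  B≢Y : ∀ {l} → l ≤ K → B l ≢ B (suc K)
  B≢Y le refl = n≮n _ le

  end-from-D0-even : p ≡ even → s ≡ D 0 → t ≡ B 1
  end-from-D0-even pe hs with next-exists (v-X′ pe) A≢t
  ... | y , sxy with from-X (next-arc-even pe sxy)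
  ... | inj₁ refl = ⊥-elim (nothing-before hs sxy)
  ... | inj₂ refl with next-exists (v-C (s≤s z≤n) 1≤K) C≢t
  ... | y1 , scy with c-local (inj₂ pe) scy
  ... | inj₂ refl = ⊥-elim (case next-injective sxy scy of λ ())
  ... | inj₁ refl with t ≟ᵥ B 1
  ... | yes tb = tb
  ... | no tnb with next-exists (v-B (s≤s z≤n) 1≤K) (λ e → tnb (sym e))
  ... | y2 , sby with from-B (next-arc sby)
  ... | inj₂ refl = ⊥-elim (next-asym scy sby)
  ... | inj₁ refl with next-exists v-D0 (λ e → start≢end (trans hs e))
  ... | y3 , sd0 with from-D0 (next-arc sd0)
  ... | refl = ⊥-elim (case next-injective sd0 sby of λ ())

  end-from-Y-even : p ≡ even → s ≡ B (suc K) → t ≡ D K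
  end-from-Y-even pe hs with next-exists (v-Y′ pe) (λ e → start≢end (trans hs e))
  ... | y , syx with from-Y (next-arc-even pe syx)
  ... | refl with next-exists (v-X′ pe) A≢t
  ... | y1 , sxy with from-X (next-arc-even pe sxy)
  ... | inj₂ refl = ⊥-elim (no-arc-X-D1-even pe (≢start hs (λ ())) sxy)
  ... | inj₁ refl with t ≟ᵥ D 0
  ... | yes td0 = ⊥-elim (not-two-steps′ syx sxy (sym hs) (sym td0))
  ... | no tnd0 with next-exists v-D0 (λ e → tnd0 (sym e))
  ... | y2 , sd0 with from-D0 (next-arc sd0)
  ... | refl with sweep-forward K' 0 K' refl ≤-refl (λ l a b → ≢start hs (B≢Y (m≤n⇒m≤1+n b)) , ≢start hs (λ ())) sd0 (dFromC-1-even pe sxy)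
  ... | stops-at {j'} refl td h' = ⊥-elim (end≢D-forward {j'} ≤-refl (≢start hs (B≢Y (n≤1+n _))) (≢start hs (B≢Y ≤-refl)) (≢start hs (λ ())) h' td)
  ... | passes sdK neK with t ≟ᵥ D K
  ... | yes tdK = tdK
  ... | no tndK with t ≟ᵥ B K
  ... | yes tbK = ⊥-elim (end≢B 1≤K ≤-refl (c-local (inj₂ pe)) neK (≢start hs (λ ())) tbK)
  ... | no tnbK with forward-block {K'} ≤-refl (c-local (inj₂ pe)) (≢start hs (B≢Y ≤-refl)) (λ e → tnbK (sym e)) (λ e → tndK (sym e)) sdK
  ... | _ , _ , _ , sda = ⊥-elim (case next-injective sda syx of λ ())

  end-from-B-last-even : p ≡ even → s ≡ B K → t ≡ B (suc K)
  end-from-B-last-even pe hs with next-exists (v-C 1≤K ≤-refl) C≢t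
  ... | y , scy with c-local (inj₂ pe) scy
  ... | inj₁ refl = ⊥-elim (nothing-before hs scy)
  ... | inj₂ refl with previous-exists (v-C 1≤K ≤-refl) C≢s
  ... | x , sxc with into-C (next-arc sxc)
  ... | inj₂ refl = ⊥-elim (next-asym sxc scy)
  ... | inj₁ refl with next-exists (v-A 1≤K ≤-refl) A≢t
  ... | y1 , say with from-A-last-even (next-arc-even pe say)
  ... | inj₁ refl = ⊥-elim (nothing-before hs say)
  ... | inj₂ refl with t ≟ᵥ B (suc K)
  ... | yes ty = ty
  ... | no tny with next-exists (v-Y′ pe) (λ e → tny (sym e))
  ... | y2 , syx with from-Y (next-arc-even pe syx)
  ... | refl with t ≟ᵥ D K
  ... | yes td = ⊥-elim (not-two-steps′ sxc scy (sym hs) (sym td))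
  ... | no tnd with next-exists (v-D 1≤K ≤-refl) (λ e → tnd (sym e))
  ... | y3 , sdy with from-D (next-arc sdy)
  ... | inj₁ refl = ⊥-elim (next-asym scy sdy)
  ... | inj₂ refl = ⊥-elim (case next-injective sdy syx of λ ())

  reach-Y-even : p ≡ even → ∀ i' → suc i' ≤ K → s ≡ D (suc i') → Next (D (suc i')) (C (suc i')) → Next (B (suc i')) (A (suc i')) →
           Next (A K) (B (suc K)) × Next (D K) (C K)
  reach-Y-even pe i' le hs sxc sba with m≤n⇒m<n∨m≡n le
  ... | inj₂ refl with next-exists (v-A 1≤K ≤-refl) A≢t
  ... | y , say with from-A-last-even (next-arc-even pe say)
  ... | inj₁ refl = ⊥-elim (next-asym sba say)
  ... | inj₂ refl = say , sxc
  reach-Y-even pe i' le hs sxc sba | inj₁ lt with next-exists (v-A (s≤s z≤n) le) A≢t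
  ... | y , say with from-A-interior lt (next-arc say)
  ... | inj₁ refl = ⊥-elim (next-asym sba say)
  ... | inj₂ refl with sweep-backward (K' ∸ suc i') (suc i') K' (m+[n∸m]≡n (≤-pred lt)) ≤-refl
                      (λ l a b → ≢start hs (λ ()) , ≢start hs (D≢> a)) say sxc
  ... | sak , sdc' with t ≟ᵥ D K
  ... | yes tdK = ⊥-elim (end≢D-last-backward (≢start hs (λ ())) sak sdc' tdK)
  ... | no tndK with t ≟ᵥ B K
  ... | yes tbK = ⊥-elim (end≢B-backward {K'} ≤-refl sdc' tbK)
  ... | no tnbK with backward-block 1≤K ≤-refl (c-local (inj₂ pe)) (≢start hs (λ ())) (λ e → tnbK (sym e)) sak (λ ())
  ... | sdcK , scbK , sbaK with next-exists (v-A 1≤K ≤-refl) A≢t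
  ... | y2 , say2 with from-A-last-even (next-arc-even pe say2)
  ... | inj₁ refl = ⊥-elim (next-asym sbaK say2)
  ... | inj₂ refl = say2 , sdcK

  end-from-D-even : p ≡ even → ∀ i' → suc i' ≤ K → s ≡ D (suc i') → t ≡ D i'
  end-from-D-even pe i' le hs with next-exists (v-C (s≤s z≤n) le) C≢t
  ... | y , scy with c-local (inj₂ pe) scy
  ... | inj₂ refl = ⊥-elim (nothing-before hs scy)
  ... | inj₁ refl with previous-exists (v-C (s≤s z≤n) le) C≢s
  ... | x , sxc with into-C (next-arc sxc)
  ... | inj₁ refl = ⊥-elim (next-asym sxc scy)
  ... | inj₂ refl with t ≟ᵥ B (suc i')
  ... | yes tb = ⊥-elim (not-two-steps′ sxc scy (sym hs) (sym tb))
  ... | no tnb with next-exists (v-B (s≤s z≤n) le) (λ e → tnb (sym e))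
  ... | y2 , sby with from-B (next-arc sby)
  ... | inj₂ refl = ⊥-elim (next-asym scy sby)
  ... | inj₁ refl with reach-Y-even pe i' le hs sxc sby
  ... | say , sdcK with t ≟ᵥ B (suc K)
  ... | yes ty = ⊥-elim (end≢Y-even pe ty sdcK)
  ... | no tny with next-exists (v-Y′ pe) (λ e → tny (sym e))
  ... | y3 , syx with from-Y (next-arc-even pe syx)
  ... | refl with next-exists (v-X′ pe) A≢t
  ... | y4 , sxy with from-X (next-arc-even pe sxy)
  ... | inj₂ refl = ⊥-elim (no-arc-X-D1 i' hs)
    where
    no-arc-X-D1 : ∀ i' → s ≡ D (suc i') → ⊥
    no-arc-X-D1 zero hs′ = nothing-before hs′ sxy
    no-arc-X-D1 (suc _) hs′ = no-arc-X-D1-even pe (≢start hs′ (λ ())) sxy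
  ... | inj₁ refl = end-via-D0 i' le hs (dFromC-1-even pe sxy) sby
-- S_k as a block graph

-- Vertex n of S_k; the shift by 2 puts vertex 1 at D 0.
vertex : ℕ → Vertex
vertex n = decode (2 + n)

vertex-injective : ∀ {a b} → vertex a ≡ vertex b → a ≡ b
vertex-injective {a} {b} e =
  suc-injective (suc-injective (trans (sym (code-decode (2 + a))) (trans (cong code e) (code-decode (2 + b)))))

vertex-≡ : ∀ {n} v → 2 + n ≡ code v → vertex n ≡ v
vertex-≡ v e = trans (cong decode e) (decode-code v)

vertex-∸ : ∀ {a} c b v → a ≡ c + b → 2 + b ≡ code v → vertex (a ∸ c) ≡ v
vertex-∸ c b v a≡c+b e = vertex-≡ v (trans (cong (λ n → 2 + (n ∸ c)) a≡c+b) (trans (cong (2 +_) (m+n∸m≡n c b)) e))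

vertex-A : ∀ i → vertex (4 * suc i ∸ 2) ≡ A (suc i)
vertex-A i = vertex-∸ 2 (2 + 4 * i) (A (suc i)) (*-suc 4 i) (sym (*-suc 4 i))

vertex-B : ∀ i → vertex (4 * suc i ∸ 1) ≡ B (suc i)
vertex-B i = vertex-∸ 1 (3 + 4 * i) (B (suc i)) (*-suc 4 i) (cong suc (sym (*-suc 4 i)))

vertex-C : ∀ i → vertex (4 * suc i) ≡ C (suc i)
vertex-C i = vertex-≡ (C (suc i)) refl

vertex-D : ∀ i → vertex (4 * suc i + 1) ≡ D (suc i)
vertex-D i = vertex-≡ (D (suc i)) (cong (2 +_) (+-comm (4 * suc i) 1))

vertex-A-next : ∀ i → vertex (4 * suc i + 2) ≡ A (suc (suc i))
vertex-A-next i = vertex-≡ (A (suc (suc i))) (trans (cong (2 +_) (+-comm (4 * suc i) 2)) (sym (*-suc 4 (suc i))))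

vertex-D-next : ∀ i → vertex (4 * suc i + 5) ≡ D (suc (suc i))
vertex-D-next i =
  vertex-≡ (D (suc (suc i))) (trans (cong (2 +_) (+-comm (4 * suc i) 5)) (cong (3 +_) (sym (*-suc 4 (suc i)))))

vertex-B-next : ∀ i → vertex (4 * suc i + 3) ≡ B (suc (suc i))
vertex-B-next i = vertex-≡ (B (suc (suc i))) (eq i)
  where
  eq : ∀ i → 2 + (4 * suc i + 3) ≡ 1 + 4 * suc (suc i)
  eq = solve-∀

vertex-D-prev : ∀ i → vertex (4 * suc i ∸ 3) ≡ D i
vertex-D-prev i = vertex-∸ 3 (1 + 4 * i) (D i) (*-suc 4 i) refl

halve-≤ : ∀ a b c → 2 * a + c ≤ 2 * b + c → a ≤ b
halve-≤ a b c le = *-cancelˡ-≤ 2 (+-cancelʳ-≤ c (2 * a) (2 * b) le)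

2a≤2b+1⇒a≤b : ∀ a b → 2 * a ≤ 2 * b + 1 → a ≤ b
2a≤2b+1⇒a≤b a b le with a ≤? b
... | yes a≤b = a≤b
... | no a≰b = ⊥-elim (1+n≰n (≤-trans (subst (_≤ 2 * a) (eq b) (*-monoʳ-≤ 2 (≰⇒> a≰b))) le))
  where
  eq : ∀ b → 2 * suc b ≡ suc (2 * b + 1)
  eq = solve-∀

2a+1≤2b+2⇒a≤b : ∀ a b → 2 * a + 1 ≤ 2 * b + 2 → a ≤ b
2a+1≤2b+2⇒a≤b a b le = 2a≤2b+1⇒a≤b a b (≤-pred (subst₂ _≤_ (+-comm (2 * a) 1) (eq b) le))
  where
  eq : ∀ b → 2 * b + 2 ≡ suc (2 * b + 1)
  eq = solve-∀

arc-via : ∀ {p K v′ w′ v w} → v′ ≡ v → w′ ≡ w → Arc p K v w → Arc p K v′ w′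
arc-via refl refl a = a

module _ (K' : ℕ) where

  vertex-2k∸4-odd : vertex (2 * (2 * K' + 3) ∸ 4) ≡ A (suc K')
  vertex-2k∸4-odd = vertex-∸ 4 (4 * K' + 2) (A (suc K')) (eq₁ K') (eq₂ K')
    where
    eq₁ : ∀ K' → 2 * (2 * K' + 3) ≡ 4 + (4 * K' + 2)
    eq₁ = solve-∀
    eq₂ : ∀ K' → 2 + (4 * K' + 2) ≡ 4 * suc K'
    eq₂ = solve-∀

  vertex-2k∸2-odd : vertex (2 * (2 * K' + 3) ∸ 2) ≡ C (suc K')
  vertex-2k∸2-odd = vertex-∸ 2 (4 * K' + 4) (C (suc K')) (eq₁ K') (eq₂ K')
    where
    eq₁ : ∀ K' → 2 * (2 * K' + 3) ≡ 2 + (4 * K' + 4)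
    eq₁ = solve-∀
    eq₂ : ∀ K' → 2 + (4 * K' + 4) ≡ 2 + 4 * suc K'
    eq₂ = solve-∀

  vertex-2k∸1-odd : vertex (2 * (2 * K' + 3) ∸ 1) ≡ D (suc K')
  vertex-2k∸1-odd = vertex-∸ 1 (4 * K' + 5) (D (suc K')) (eq₁ K') (eq₂ K')
    where
    eq₁ : ∀ K' → 2 * (2 * K' + 3) ≡ 1 + (4 * K' + 5)
    eq₁ = solve-∀
    eq₂ : ∀ K' → 2 + (4 * K' + 5) ≡ 3 + 4 * suc K'
    eq₂ = solve-∀

  vertex-2k∸5-odd : vertex (2 * (2 * K' + 3) ∸ 5) ≡ D K'
  vertex-2k∸5-odd = vertex-∸ 5 (4 * K' + 1) (D K') (eq₁ K') (eq₂ K')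
    where
    eq₁ : ∀ K' → 2 * (2 * K' + 3) ≡ 5 + (4 * K' + 1)
    eq₁ = solve-∀
    eq₂ : ∀ K' → 2 + (4 * K' + 1) ≡ 3 + 4 * K'
    eq₂ = solve-∀

  vertex-2k∸6-even : vertex (2 * (2 * K' + 4) ∸ 6) ≡ A (suc K')
  vertex-2k∸6-even = vertex-∸ 6 (4 * K' + 2) (A (suc K')) (eq₁ K') (eq₂ K')
    where
    eq₁ : ∀ K' → 2 * (2 * K' + 4) ≡ 6 + (4 * K' + 2)
    eq₁ = solve-∀
    eq₂ : ∀ K' → 2 + (4 * K' + 2) ≡ 4 * suc K'
    eq₂ = solve-∀

  vertex-2k∸3-even : vertex (2 * (2 * K' + 4) ∸ 3) ≡ D (suc K')
  vertex-2k∸3-even = vertex-∸ 3 (4 * K' + 5) (D (suc K')) (eq₁ K') (eq₂ K')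
    where
    eq₁ : ∀ K' → 2 * (2 * K' + 4) ≡ 3 + (4 * K' + 5)
    eq₁ = solve-∀
    eq₂ : ∀ K' → 2 + (4 * K' + 5) ≡ 3 + 4 * suc K'
    eq₂ = solve-∀

  vertex-2k∸2-even : vertex (2 * (2 * K' + 4) ∸ 2) ≡ A (suc (suc K'))
  vertex-2k∸2-even = vertex-∸ 2 (4 * K' + 6) (A (suc (suc K'))) (eq₁ K') (eq₂ K')
    where
    eq₁ : ∀ K' → 2 * (2 * K' + 4) ≡ 2 + (4 * K' + 6)
    eq₁ = solve-∀
    eq₂ : ∀ K' → 2 + (4 * K' + 6) ≡ 4 * suc (suc K')
    eq₂ = solve-∀

  vertex-2k∸1-even : vertex (2 * (2 * K' + 4) ∸ 1) ≡ B (suc (suc K'))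
  vertex-2k∸1-even = vertex-∸ 1 (4 * K' + 7) (B (suc (suc K'))) (eq₁ K') (eq₂ K')
    where
    eq₁ : ∀ K' → 2 * (2 * K' + 4) ≡ 1 + (4 * K' + 7)
    eq₁ = solve-∀
    eq₂ : ∀ K' → 2 + (4 * K' + 7) ≡ 1 + 4 * suc (suc K')
    eq₂ = solve-∀

  vertex-2k∸7-even : vertex (2 * (2 * K' + 4) ∸ 7) ≡ D K'
  vertex-2k∸7-even = vertex-∸ 7 (4 * K' + 1) (D K') (eq₁ K') (eq₂ K')
    where
    eq₁ : ∀ K' → 2 * (2 * K' + 4) ≡ 7 + (4 * K' + 1)
    eq₁ = solve-∀
    eq₂ : ∀ K' → 2 + (4 * K' + 1) ≡ 3 + 4 * K'
    eq₂ = solve-∀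

2K'+3-not-even : ∀ K' → ¬ IsEven (2 * K' + 3)
2K'+3-not-even K' k-even = case trans (sym k-even) (trans (cong (_% 2) (eq K')) ([m+kn]%n≡m%n 1 (K' + 1) 2)) of λ ()
  where
  eq : ∀ K' → 2 * K' + 3 ≡ 1 + (K' + 1) * 2
  eq = solve-∀

2K'+4-not-odd : ∀ K' → ¬ IsOdd (2 * K' + 4)
2K'+4-not-odd K' k-odd = case trans (sym k-odd) (trans (cong (_% 2) (eq K')) ([m+kn]%n≡m%n 0 (K' + 2) 2)) of λ ()
  where
  eq : ∀ K' → 2 * K' + 4 ≡ 0 + (K' + 2) * 2
  eq = solve-∀

2K'+3≡2[1+K']+1 : ∀ K' → 2 * K' + 3 ≡ 2 * suc K' + 1
2K'+3≡2[1+K']+1 = solve-∀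

2K'+3≡1+2[1+K'] : ∀ K' → 2 * K' + 3 ≡ 1 + 2 * suc K'
2K'+3≡1+2[1+K'] = solve-∀

2K'+4≡2[1+K']+2 : ∀ K' → 2 * K' + 4 ≡ 2 * suc K' + 2
2K'+4≡2[1+K']+2 = solve-∀

2K'+4≡2+2[1+K'] : ∀ K' → 2 * K' + 4 ≡ 2 + 2 * suc K'
2K'+4≡2+2[1+K'] = solve-∀

2K'+4≡1+2[1+K']+1 : ∀ K' → 2 * K' + 4 ≡ 1 + (2 * suc K' + 1)
2K'+4≡1+2[1+K']+1 = solve-∀

2K'+4≡2[2+K'] : ∀ K' → 2 * K' + 4 ≡ 2 * suc (suc K')
2K'+4≡2[2+K'] = solve-∀

m+m≡2m : ∀ i → suc i + suc i ≡ 2 * suc i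
m+m≡2m = solve-∀

1+m+m≡2m+1 : ∀ i → suc (suc i + suc i) ≡ 2 * suc i + 1
1+m+m≡2m+1 = solve-∀

vertex-inV-even : ∀ i → vertex (inV (suc i + suc i)) ≡ B (suc i)
vertex-inV-even i = vertex-∸ 1 (3 + 4 * i) (B (suc i)) (eq i) (cong suc (sym (*-suc 4 i)))
  where
  eq : ∀ i → 2 * (suc i + suc i) ≡ 1 + (3 + 4 * i)
  eq = solve-∀

vertex-inV-odd : ∀ i → vertex (inV (suc (suc i + suc i))) ≡ D (suc i)
vertex-inV-odd i = vertex-∸ 1 (4 * suc i + 1) (D (suc i)) (eq i) (cong (2 +_) (+-comm (4 * suc i) 1))
  where
  eq : ∀ i → 2 * suc (suc i + suc i) ≡ 1 + (4 * suc i + 1)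
  eq = solve-∀

in-block-odd : ∀ {i} K' → 2 * i + 1 ≤ 2 * K' + 3 → i ≤ suc K'
in-block-odd {i} K' le = halve-≤ i (suc K') 1 (subst (2 * i + 1 ≤_) (2K'+3≡2[1+K']+1 K') le)

in-block-even : ∀ {i} K' → 2 * i + 2 ≤ 2 * K' + 4 → i ≤ suc K'
in-block-even {i} K' le = halve-≤ i (suc K') 2 (subst (2 * i + 2 ≤_) (2K'+4≡2[1+K']+2 K') le)

arc-odd : ∀ K' {x y} → Edge (2 * K' + 3) x y → Arc odd (suc K') (vertex x) (vertex y)
arc-odd K' (ev-a e _ _ _) = ⊥-elim (2K'+3-not-even K' e)
arc-odd K' (ev-a' e _ _ _) = ⊥-elim (2K'+3-not-even K' e)
arc-odd K' (ev-b e _ _ _) = ⊥-elim (2K'+3-not-even K' e)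
arc-odd K' (ev-b' e _ _ _) = ⊥-elim (2K'+3-not-even K' e)
arc-odd K' (ev-c e _ _ _) = ⊥-elim (2K'+3-not-even K' e)
arc-odd K' (ev-c' e _ _ _) = ⊥-elim (2K'+3-not-even K' e)
arc-odd K' (ev-d e _ _ _) = ⊥-elim (2K'+3-not-even K' e)
arc-odd K' (ev-e e _ _ _) = ⊥-elim (2K'+3-not-even K' e)
arc-odd K' (ev-f1 e) = ⊥-elim (2K'+3-not-even K' e)
arc-odd K' (ev-f2 e) = ⊥-elim (2K'+3-not-even K' e)
arc-odd K' (ev-f3 e) = ⊥-elim (2K'+3-not-even K' e)
arc-odd K' (ev-f4 e) = ⊥-elim (2K'+3-not-even K' e)
arc-odd K' (ev-f5 e) = ⊥-elim (2K'+3-not-even K' e)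
arc-odd K' (ev-f6 e) = ⊥-elim (2K'+3-not-even K' e)
arc-odd K' (od-a _ (suc i) (s≤s z≤n) b) = arc-via (vertex-A i) (vertex-B i) (ab (suc i) (s≤s z≤n) (in-block-odd K' b))
arc-odd K' (od-a' _ (suc i) (s≤s z≤n) b) = arc-via (vertex-B i) (vertex-A i) (ba (suc i) (s≤s z≤n) (in-block-odd K' b))
arc-odd K' (od-b _ (suc i) (s≤s z≤n) b) = arc-via (vertex-B i) (vertex-C i) (bc (suc i) (s≤s z≤n) (in-block-odd K' b))
arc-odd K' (od-b' _ (suc i) (s≤s z≤n) b) = arc-via (vertex-C i) (vertex-B i) (cb (suc i) (s≤s z≤n) (in-block-odd K' b))
arc-odd K' (od-c _ (suc i) (s≤s z≤n) b) = arc-via (vertex-C i) (vertex-D i) (cd (suc i) (s≤s z≤n) (in-block-odd K' b))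
arc-odd K' (od-c' _ (suc i) (s≤s z≤n) b) = arc-via (vertex-D i) (vertex-C i) (dc (suc i) (s≤s z≤n) (in-block-odd K' b))
arc-odd K' (od-d _ (suc i) (s≤s z≤n) b) = arc-via (vertex-A i) (vertex-D-next i) (ad (suc i) (s≤s z≤n) (s≤s (halve-≤ (suc i) K' 3 b)))
arc-odd K' (od-e _ (suc i) (s≤s z≤n) b) = arc-via (vertex-D i) (vertex-A-next i) (da (suc i) (s≤s z≤n) (s≤s (halve-≤ (suc i) K' 3 b)))
arc-odd K' (od-f1 _) = d0-a1
arc-odd K' (od-f2 _) = arc-via (vertex-2k∸4-odd K') refl ak-d0
arc-odd K' (od-f3 _) = arc-via (vertex-2k∸2-odd K') refl ck-d1

arc-even : ∀ K' {x y} → Edge (2 * K' + 4) x y → Arc even (suc K') (vertex x) (vertex y)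
arc-even K' (od-a e _ _ _) = ⊥-elim (2K'+4-not-odd K' e)
arc-even K' (od-a' e _ _ _) = ⊥-elim (2K'+4-not-odd K' e)
arc-even K' (od-b e _ _ _) = ⊥-elim (2K'+4-not-odd K' e)
arc-even K' (od-b' e _ _ _) = ⊥-elim (2K'+4-not-odd K' e)
arc-even K' (od-c e _ _ _) = ⊥-elim (2K'+4-not-odd K' e)
arc-even K' (od-c' e _ _ _) = ⊥-elim (2K'+4-not-odd K' e)
arc-even K' (od-d e _ _ _) = ⊥-elim (2K'+4-not-odd K' e)
arc-even K' (od-e e _ _ _) = ⊥-elim (2K'+4-not-odd K' e)
arc-even K' (od-f1 e) = ⊥-elim (2K'+4-not-odd K' e)
arc-even K' (od-f2 e) = ⊥-elim (2K'+4-not-odd K' e)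
arc-even K' (od-f3 e) = ⊥-elim (2K'+4-not-odd K' e)
arc-even K' (ev-a _ (suc i) (s≤s z≤n) b) = arc-via (vertex-A i) (vertex-B i) (ab (suc i) (s≤s z≤n) (in-block-even K' b))
arc-even K' (ev-a' _ (suc i) (s≤s z≤n) b) = arc-via (vertex-B i) (vertex-A i) (ba (suc i) (s≤s z≤n) (in-block-even K' b))
arc-even K' (ev-b _ (suc i) (s≤s z≤n) b) = arc-via (vertex-B i) (vertex-C i) (bc (suc i) (s≤s z≤n) (in-block-even K' b))
arc-even K' (ev-b' _ (suc i) (s≤s z≤n) b) = arc-via (vertex-C i) (vertex-B i) (cb (suc i) (s≤s z≤n) (in-block-even K' b))
arc-even K' (ev-c _ (suc i) (s≤s z≤n) b) = arc-via (vertex-C i) (vertex-D i) (cd (suc i) (s≤s z≤n) (in-block-even K' b))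
arc-even K' (ev-c' _ (suc i) (s≤s z≤n) b) = arc-via (vertex-D i) (vertex-C i) (dc (suc i) (s≤s z≤n) (in-block-even K' b))
arc-even K' (ev-d _ (suc i) (s≤s z≤n) b) = arc-via (vertex-A i) (vertex-D-next i) (ad (suc i) (s≤s z≤n) (s≤s (halve-≤ (suc i) K' 4 b)))
arc-even K' (ev-e _ (suc i) (s≤s z≤n) b) = arc-via (vertex-D i) (vertex-A-next i) (da (suc i) (s≤s z≤n) (s≤s (halve-≤ (suc i) K' 4 b)))
arc-even K' (ev-f1 _) = d0-a1
arc-even K' (ev-f2 _) = arc-via (vertex-2k∸6-even K') (vertex-2k∸1-even K') ak-y
arc-even K' (ev-f3 _) = arc-via (vertex-2k∸3-even K') (vertex-2k∸2-even K') dk-x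
arc-even K' (ev-f4 _) = arc-via (vertex-2k∸2-even K') refl x-d0
arc-even K' (ev-f5 _) = arc-via (vertex-2k∸2-even K') refl x-d1
arc-even K' (ev-f6 _) = arc-via (vertex-2k∸1-even K') (vertex-2k∸2-even K') y-x

-- Hamiltonian paths of S_k

even-or-odd : ∀ n → (∃ λ m → n ≡ m + m) ⊎ (∃ λ m → n ≡ suc (m + m))
even-or-odd zero = inj₁ (0 , refl)
even-or-odd (suc n) with even-or-odd n
... | inj₁ (m , n≡m+m) = inj₂ (m , cong suc n≡m+m)
... | inj₂ (m , n≡1+m+m) = inj₁ (suc m , cong suc (trans n≡1+m+m (sym (+-suc m m))))

data Size : ℕ → Set where
  odd-size  : ∀ K' → 1 ≤ K' → Size (2 * K' + 3)
  even-size : ∀ K' → Size (2 * K' + 4)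

size : ∀ k → 4 ≤ k → Size k
size k 4≤k with even-or-odd k
size _ () | inj₁ (0 , refl)
size _ (s≤s (s≤s ())) | inj₁ (1 , refl)
size _ (s≤s ()) | inj₂ (0 , refl)
size _ (s≤s (s≤s (s≤s ()))) | inj₂ (1 , refl)
... | inj₁ (suc (suc K') , refl) = subst Size (m+m≡2K'+4 K') (even-size K')
  where
  m+m≡2K'+4 : ∀ K' → 2 * K' + 4 ≡ suc (suc K') + suc (suc K')
  m+m≡2K'+4 = solve-∀
... | inj₂ (suc (suc K') , refl) = subst Size (1+m+m≡2K'+3 K') (odd-size (suc K') (s≤s z≤n))
  where
  1+m+m≡2K'+3 : ∀ K' → 2 * suc K' + 3 ≡ suc (suc (suc K') + suc (suc K'))
  1+m+m≡2K'+3 = solve-∀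

-- order p K' is 2k − 1, the number of vertices of S_k.
order : Parity → ℕ → ℕ
order odd K' = 5 + 4 * K'
order even K' = 7 + 4 * K'

5+4K'≤order : ∀ p K' → 5 + 4 * K' ≤ order p K'
5+4K'≤order odd K' = ≤-refl
5+4K'≤order even K' = +-monoˡ-≤ (4 * K') (m≤m+n 5 2)

a+4i≤order : ∀ p {K' i} a → a ≤ 5 → i ≤ K' → a + 4 * i ≤ order p K'
a+4i≤order p {K'} a a≤5 i≤K' = ≤-trans (+-mono-≤ a≤5 (*-monoʳ-≤ 4 i≤K')) (5+4K'≤order p K')

labelled : ∀ {p K' w} → IsVertex p (suc K') w → ∃ λ n → (1 ≤ n × n ≤ order p K') × vertex n ≡ w
labelled {p} v-D0 = 1 , (s≤s z≤n , a+4i≤order p 1 (s≤s z≤n) z≤n) , refl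
labelled {p} (v-A {i = suc i} _ (s≤s i≤K')) =
  2 + 4 * i , (s≤s z≤n , a+4i≤order p 2 (m≤m+n 2 3) i≤K') , vertex-≡ (A (suc i)) (sym (*-suc 4 i))
labelled {p} (v-B {i = suc i} _ (s≤s i≤K')) =
  3 + 4 * i , (s≤s z≤n , a+4i≤order p 3 (m≤m+n 3 2) i≤K') , vertex-≡ (B (suc i)) (cong (1 +_) (sym (*-suc 4 i)))
labelled {p} (v-C {i = suc i} _ (s≤s i≤K')) =
  4 + 4 * i , (s≤s z≤n , a+4i≤order p 4 (m≤m+n 4 1) i≤K') , vertex-≡ (C (suc i)) (cong (2 +_) (sym (*-suc 4 i)))
labelled {p} (v-D {i = suc i} _ (s≤s i≤K')) =
  5 + 4 * i , (s≤s z≤n , a+4i≤order p 5 ≤-refl i≤K') , vertex-≡ (D (suc i)) (cong (3 +_) (sym (*-suc 4 i)))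
labelled {K' = K'} v-X =
  6 + 4 * K' , (s≤s z≤n , n≤1+n _) , vertex-≡ (A (suc (suc K'))) (trans (cong (4 +_) (sym (*-suc 4 K'))) (sym (*-suc 4 (suc K'))))
labelled {K' = K'} v-Y =
  7 + 4 * K' , (s≤s z≤n , ≤-refl) , vertex-≡ (B (suc (suc K'))) (cong (1 +_) (trans (cong (4 +_) (sym (*-suc 4 K'))) (sym (*-suc 4 (suc K')))))

order-odd : ∀ K' → 2 * (2 * K' + 3) ∸ 1 ≡ order odd K'
order-odd K' = cong (_∸ 1) (eq K')
  where
  eq : ∀ K' → 2 * (2 * K' + 3) ≡ 1 + (5 + 4 * K')
  eq = solve-∀

order-even : ∀ K' → 2 * (2 * K' + 4) ∸ 1 ≡ order even K'
order-even K' = cong (_∸ 1) (eq K')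
  where
  eq : ∀ K' → 2 * (2 * K' + 4) ≡ 1 + (7 + 4 * K')
  eq = solve-∀

-- Source p K' j v : v is the incoming vertex i_j of S_k, k = 2K'+3 (odd) or 2K'+4 (even).
data Source : Parity → ℕ → ℕ → Vertex → Set where
  source-D0 : ∀ {p K'} → Source p K' 1 (D 0)
  source-B : ∀ {p K'} i → i ≤ K' → Source p K' (2 * suc i) (B (suc i))
  source-Y : ∀ {K'} → Source even K' (2 * suc (suc K')) (B (suc (suc K')))
  source-D : ∀ {p K'} i → i ≤ K' → Source p K' (2 * suc i + 1) (D (suc i))

-- Sink p K' m v : v is the outgoing vertex o_m.
data Sink : Parity → ℕ → ℕ → Vertex → Set where
  sink-B : ∀ {p K'} i → i ≤ K' → Sink p K' (2 * suc i) (B (suc (suc i)))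
  sink-B1-odd : ∀ {K'} → Sink odd K' (2 * suc K') (B 1)
  sink-B1-even : ∀ {K'} → Sink even K' 1 (B 1)
  sink-D : ∀ {p K'} i → i ≤ K' → Sink p K' (2 * suc i + 1) (D i)
  sink-D-last-odd : ∀ {K'} → Sink odd K' 1 (D (suc K'))
  sink-D-last-even : ∀ {K'} → Sink even K' (2 * suc (suc K')) (D (suc K'))

sink-IsBD : ∀ {p K' m v} → Sink p K' m v → IsBD v
sink-IsBD (sink-B _ _) = bd-B
sink-IsBD sink-B1-odd = bd-B
sink-IsBD sink-B1-even = bd-B
sink-IsBD (sink-D _ _) = bd-D
sink-IsBD sink-D-last-odd = bd-D
sink-IsBD sink-D-last-even = bd-D

source-via : ∀ {p K' j j′ v v′} → j ≡ j′ → v ≡ v′ → Source p K' j′ v′ → Source p K' j v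
source-via refl refl src = src

sink-via : ∀ {p K' m m′ v v′} → m ≡ m′ → v ≡ v′ → Sink p K' m′ v′ → Sink p K' m v
sink-via refl refl snk = snk

source-odd : ∀ K' j → 1 ≤ j → j ≤ 2 * K' + 3 → Source odd K' j (vertex (inV j))
source-odd K' j 1≤j j≤k with even-or-odd j
source-odd K' .0 () j≤k | inj₁ (0 , refl)
source-odd K' .(suc i + suc i) _ j≤k | inj₁ (suc i , refl) =
  source-via (m+m≡2m i) (vertex-inV-even i)
    (source-B i (≤-pred (2a≤2b+1⇒a≤b (suc i) (suc K') (subst₂ _≤_ (m+m≡2m i) (2K'+3≡2[1+K']+1 K') j≤k))))
source-odd K' .1 _ j≤k | inj₂ (0 , refl) = source-D0
source-odd K' .(suc (suc i + suc i)) _ j≤k | inj₂ (suc i , refl) =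
  source-via (1+m+m≡2m+1 i) (vertex-inV-odd i)
    (source-D i (≤-pred (halve-≤ (suc i) (suc K') 1 (subst₂ _≤_ (1+m+m≡2m+1 i) (2K'+3≡2[1+K']+1 K') j≤k))))

source-even : ∀ K' j → 1 ≤ j → j ≤ 2 * K' + 4 → Source even K' j (vertex (inV j))
source-even K' j 1≤j j≤k with even-or-odd j
source-even K' .0 () j≤k | inj₁ (0 , refl)
source-even K' .(suc i + suc i) _ j≤k | inj₁ (suc i , refl)
  with m≤n⇒m<n∨m≡n (≤-pred (*-cancelˡ-≤ 2 (subst₂ _≤_ (m+m≡2m i) (2K'+4≡2[2+K'] K') j≤k)))
... | inj₁ i<1+K' = source-via (m+m≡2m i) (vertex-inV-even i) (source-B i (≤-pred i<1+K'))
... | inj₂ refl = source-via (m+m≡2m i) (vertex-inV-even i) source-Y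
source-even K' .1 _ j≤k | inj₂ (0 , refl) = source-D0
source-even K' .(suc (suc i + suc i)) _ j≤k | inj₂ (suc i , refl) =
  source-via (1+m+m≡2m+1 i) (vertex-inV-odd i)
    (source-D i (≤-pred (2a+1≤2b+2⇒a≤b (suc i) (suc K') (subst₂ _≤_ (1+m+m≡2m+1 i) (2K'+4≡2[1+K']+2 K') j≤k))))

sink-odd : ∀ K' {m v} → Out (2 * K' + 3) m v → Sink odd K' m (vertex v)
sink-odd K' (o-even (suc q) _ b) = sink-via refl (vertex-B-next q) (sink-B q (<⇒≤ (halve-≤ (suc q) K' 3 b)))
sink-odd K' (o-odd (suc q) _ b) = sink-via refl (vertex-D-prev q) (sink-D q (<⇒≤ (halve-≤ (suc q) K' 3 b)))
sink-odd K' (ev-o1 e) = ⊥-elim (2K'+3-not-even K' e)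
sink-odd K' (ev-ok2 e) = ⊥-elim (2K'+3-not-even K' e)
sink-odd K' (ev-ok1 e) = ⊥-elim (2K'+3-not-even K' e)
sink-odd K' (ev-ok e) = ⊥-elim (2K'+3-not-even K' e)
sink-odd K' (od-o1 _) = sink-via refl (vertex-2k∸1-odd K') sink-D-last-odd
sink-odd K' (od-ok1 _) = sink-via (cong (_∸ 1) (2K'+3≡1+2[1+K'] K')) refl sink-B1-odd
sink-odd K' (od-ok _) = sink-via (2K'+3≡2[1+K']+1 K') (vertex-2k∸5-odd K') (sink-D K' ≤-refl)

sink-index-bound-even : ∀ {q} K' → 2 * suc q + 3 ≤ 2 * K' + 4 → q ≤ K'
sink-index-bound-even {q} K' le =
  halve-≤ q K' 5 (≤-trans (subst (_≤ 2 * K' + 4) (eq q) le) (+-monoʳ-≤ (2 * K') (n≤1+n 4)))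
  where
  eq : ∀ q → 2 * suc q + 3 ≡ 2 * q + 5
  eq = solve-∀

sink-even : ∀ K' {m v} → Out (2 * K' + 4) m v → Sink even K' m (vertex v)
sink-even K' (o-even (suc q) _ b) = sink-via refl (vertex-B-next q) (sink-B q (sink-index-bound-even K' b))
sink-even K' (o-odd (suc q) _ b) = sink-via refl (vertex-D-prev q) (sink-D q (sink-index-bound-even K' b))
sink-even K' (ev-o1 _) = sink-B1-even
sink-even K' (ev-ok2 _) = sink-via (cong (_∸ 2) (2K'+4≡2+2[1+K'] K')) (vertex-2k∸1-even K') (sink-B K' ≤-refl)
sink-even K' (ev-ok1 _) = sink-via (cong (_∸ 1) (2K'+4≡1+2[1+K']+1 K')) (vertex-2k∸7-even K') (sink-D K' ≤-refl)
sink-even K' (ev-ok _) = sink-via (2K'+4≡2[2+K'] K') (vertex-2k∸3-even K') sink-D-last-even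
sink-even K' (od-o1 e) = ⊥-elim (2K'+4-not-odd K' e)
sink-even K' (od-ok1 e) = ⊥-elim (2K'+4-not-odd K' e)
sink-even K' (od-ok e) = ⊥-elim (2K'+4-not-odd K' e)

-- Route p K' s t : t is where a Hamiltonian path from s is forced to end.
data Route : Parity → ℕ → Vertex → Vertex → Set where
  route-D0-odd : ∀ {K'} → Route odd K' (D 0) (D (suc K'))
  route-D0-even : ∀ {K'} → Route even K' (D 0) (B 1)
  route-B : ∀ {p K'} i → i < K' → Route p K' (B (suc i)) (B (suc (suc i)))
  route-B-last-odd : ∀ {K'} → Route odd K' (B (suc K')) (B 1)
  route-B-last-even : ∀ {K'} → Route even K' (B (suc K')) (B (suc (suc K')))
  route-Y : ∀ {K'} → Route even K' (B (suc (suc K'))) (D (suc K'))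
  route-D : ∀ {p K'} i → i ≤ K' → Route p K' (D (suc i)) (D i)

route-index : ∀ {p K' j m s t} → Route p K' s t → Source p K' j s → Sink p K' m t → m ≡ j
route-index route-D0-odd source-D0 (sink-D _ le) = ⊥-elim (1+n≰n le)
route-index route-D0-odd source-D0 sink-D-last-odd = refl
route-index route-D0-even source-D0 sink-B1-even = refl
route-index (route-B i _) (source-B .i _) (sink-B .i _) = refl
route-index (route-B i lt) source-Y _ = ⊥-elim (1+n≰n (<⇒≤ lt))
route-index route-B-last-odd (source-B _ _) sink-B1-odd = refl
route-index route-B-last-even (source-B _ _) (sink-B _ _) = refl
route-index route-Y (source-B _ le) _ = ⊥-elim (1+n≰n le)
route-index route-Y source-Y (sink-D _ le) = ⊥-elim (1+n≰n le)
route-index route-Y source-Y sink-D-last-even = refl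
route-index (route-D i _) (source-D _ _) (sink-D _ _) = refl
route-index (route-D i le) (source-D _ _) sink-D-last-odd = ⊥-elim (1+n≰n le)
route-index (route-D i le) (source-D _ _) sink-D-last-even = ⊥-elim (1+n≰n le)

route-ends-at : ∀ {p K' s t t′} → t ≡ t′ → Route p K' s t′ → Route p K' s t
route-ends-at refl r = r

forced-route : ∀ {p K' j s t} → PathSuccessor p (suc K') s t → (p ≡ odd → 1 ≤ K') → Source p K' j s → IsBD t → Route p K' s t
forced-route {odd} P 1≤K' source-D0 t-BD = route-ends-at (end-from-D0-odd refl (1≤K' refl) refl) route-D0-odd
  where open Forcing P bd-D t-BD
forced-route {even} P _ source-D0 t-BD = route-ends-at (end-from-D0-even refl refl) route-D0-even
  where open Forcing P bd-D t-BD
forced-route {p} P 1≤K' (source-B i i≤K') t-BD with m≤n⇒m<n∨m≡n i≤K' | p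
... | inj₁ i<K' | _ = route-ends-at (end-from-B (s≤s i<K') refl) (route-B i i<K')
  where open Forcing P bd-B t-BD
... | inj₂ refl | odd = route-ends-at (end-from-B-last-odd refl (1≤K' refl) refl) route-B-last-odd
  where open Forcing P bd-B t-BD
... | inj₂ refl | even = route-ends-at (end-from-B-last-even refl refl) route-B-last-even
  where open Forcing P bd-B t-BD
forced-route P _ source-Y t-BD = route-ends-at (end-from-Y-even refl refl) route-Y
  where open Forcing P bd-B t-BD
forced-route {odd} P 1≤K' (source-D i i≤K') t-BD with m≤n⇒m<n∨m≡n i≤K'
... | inj₁ i<K' = route-ends-at (end-from-D-odd refl i i<K' refl) (route-D i i≤K')
  where open Forcing P bd-D t-BD
... | inj₂ refl = route-ends-at (end-from-D-last-odd refl (1≤K' refl) refl) (route-D i i≤K')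
  where open Forcing P bd-D t-BD
forced-route {even} P _ (source-D i i≤K') t-BD = route-ends-at (end-from-D-even refl i (s≤s i≤K') refl) (route-D i i≤K')
  where open Forcing P bd-D t-BD

A2-vertex : ∀ p K' → (p ≡ odd → 1 ≤ K') → IsVertex p (suc K') (A 2)
A2-vertex odd K' 1≤K' = v-A (s≤s z≤n) (s≤s (1≤K' refl))
A2-vertex even zero _ = v-X
A2-vertex even (suc K') _ = v-A (s≤s z≤n) (s≤s (s≤s z≤n))

path-successor : ∀ {p K' k u w} →
  (∀ {x y} → Edge k x y → Arc p (suc K') (vertex x) (vertex y)) → 2 * k ∸ 1 ≡ order p K' → (p ≡ odd → 1 ≤ K') →
  HamPathS k u w → PathSuccessor p (suc K') (vertex u) (vertex w)
path-successor {p} {K'} {k} {u} {w} arc 2k∸1≡order 1≤K' ham = record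
  { Next = Consecutive walk
  ; next-arc = consecutive-related (map⁺ (Linked.map arc edges))
  ; next-functional = consecutive-functional walk-unique
  ; next-injective = consecutive-injective walk-unique
  ; next-asym = consecutive-asym walk-unique
  ; nothing-before-start = nothing-before-head walk-unique walk-head
  ; nothing-after-end = nothing-after-last walk-unique walk-last
  ; next-exists = λ x-vertex x≢t → successor-exists walk-last (visits x-vertex) x≢t
  ; previous-exists = λ y-vertex y≢s → predecessor-exists walk-head (visits y-vertex) y≢s
  ; start≢end = λ s≡t → not-shorter-than-6 (length≡1 walk-unique walk-head (subst (λ t → last walk ≡ just t) (sym s≡t) walk-last)) (s≤s (s≤s z≤n))
  ; not-two-steps = λ c₁ c₂ → not-shorter-than-6 (length≡3 walk-unique walk-head walk-last c₁ c₂) (s≤s (s≤s (s≤s (s≤s z≤n))))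
  ; not-four-steps = λ c₁ c₂ c₃ c₄ → not-shorter-than-6 (length≡5 walk-unique walk-head walk-last c₁ c₂ c₃ c₄) ≤-refl
  }
  where
  open HamPath ham

  walk : List Vertex
  walk = map vertex path

  walk-unique : Unique walk
  walk-unique = Unique.map⁺ vertex-injective simple

  walk-head : head walk ≡ just (vertex u)
  walk-head = trans (head-map path) (cong (Maybe.map vertex) starts)

  walk-last : last walk ≡ just (vertex w)
  walk-last = trans (last-map vertex path) (cong (Maybe.map vertex) ends)

  visits : ∀ {w} → IsVertex p (suc K') w → w ∈ walk
  visits w with labelled w
  ... | n , (1≤n , n≤order) , refl = ∈-map⁺ vertex (spanning n 1≤n (subst (n ≤_) (sym 2k∸1≡order) n≤order))

  some-vertices : List Vertex
  some-vertices = D 0 ∷ A 1 ∷ B 1 ∷ C 1 ∷ D 1 ∷ A 2 ∷ []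

  at-least-six : 6 ≤ length walk
  at-least-six = unique-⊆⇒length-≤ some-vertices walk (from-yes (allPairs? (λ x y → ¬? (x ≟ᵥ y)) some-vertices))
    (visits v-D0 ∷ visits (v-A (s≤s z≤n) (s≤s z≤n)) ∷ visits (v-B (s≤s z≤n) (s≤s z≤n)) ∷ visits (v-C (s≤s z≤n) (s≤s z≤n))
      ∷ visits (v-D (s≤s z≤n) (s≤s z≤n)) ∷ visits (A2-vertex p K' 1≤K') ∷ [])

  not-shorter-than-6 : ∀ {n} → length walk ≡ n → n < 6 → ⊥
  not-shorter-than-6 refl n<6 = 1+n≰n (≤-trans n<6 at-least-six)

end-index≡start-index : ∀ {p K' k j m v} →
  (∀ {x y} → Edge k x y → Arc p (suc K') (vertex x) (vertex y)) → 2 * k ∸ 1 ≡ order p K' → (p ≡ odd → 1 ≤ K') →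
  Source p K' j (vertex (inV j)) → Sink p K' m (vertex v) → HamPathS k (inV j) v → m ≡ j
end-index≡start-index arc 2k∸1≡order 1≤K' src snk ham =
  route-index (forced-route (path-successor arc 2k∸1≡order 1≤K' ham) 1≤K' src (sink-IsBD snk)) src snk

theorem2 : (k : ℕ) → 4 ≤ k → (j m : ℕ) → 1 ≤ j → j ≤ k → 1 ≤ m → m ≤ k →
    ¬ (j ≡ m) → (v : ℕ) → Out k m v → ¬ HamPathS k (inV j) v
theorem2 k 4≤k j m 1≤j j≤k _ _ j≢m v out ham with size k 4≤k
... | odd-size K' 1≤K' =
  j≢m (sym (end-index≡start-index (arc-odd K') (order-odd K') (λ _ → 1≤K') (source-odd K' j 1≤j j≤k) (sink-odd K' out) ham))
... | even-size K' =
  j≢m (sym (end-index≡start-index (arc-even K') (order-even K') (λ ()) (source-even K' j 1≤j j≤k) (sink-even K' out) ham))
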